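{- Let $k\geq 1$ and $\tau\in S_k(132,213)$. Then: (i) there exist integers $k+1=r_0>r_1>\dots>r_m\geq 1$ such that $$\tau=(r_1,r_1+1,\dots,k,\;r_2,r_2+1,\dots,r_1-1,\;\dots,\;r_m,r_m+1,\dots,r_{m-1}-1);$$ (ii) for any such representation, writing $t_i=r_{i-1}-r_i$ for $1\leq i\leq m$, the generating function $c_\tau(x)=\sum_{n\geq 0}|S_n(132,213,\tau)|x^n$ equals $\det M$, where $M$ is the $m\times m$ matrix with entries $M_{i,1}=f_{t_i}(x)$ for $1\leq i\leq m$, $M_{i,i}=1$ for $2\leq i\leq m$, $M_{i,i+1}=-g_{t_i}(x)$ for $1\leq i\leq m-1$, and all other entries $0$: $$c_\tau(x)=\left|\begin{array}{ccccc} f_{t_1}(x) & -g_{t_1}(x) & 0 & \dots & 0\\ f_{t_2}(x) & 1 & -g_{t_2}(x) & \dots & 0\\ \vdots & \vdots & \ddots & \ddots & \vdots\\ f_{t_{m-1}}(x) & 0 & \dots & 1 & -g_{t_{m-1}}(x)\\ f_{t_m}(x) & 0 & \dots & 0 & 1 \end{array}\right|,$$ where $f_d(x)=\frac{1-x}{1-2x+x^d}$ and $g_d(x)=\frac{x^d}{1-2x+x^d}$.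
   Context: Permutations are written in one-line notation; $S_k$ is the set of permutations of $\{1,\dots,k\}$, and $S_0$ consists of the empty permutation. A permutation $\alpha\in S_n$ contains a pattern $\beta\in S_j$ if some subsequence of $\alpha$ of length $j$ is order-isomorphic to $\beta$; otherwise $\alpha$ avoids $\beta$. $S_n(\beta^1,\dots,\beta^s)$ denotes the set of permutations in $S_n$ avoiding each of $\beta^1,\dots,\beta^s$. -}

module Defs where

open import Data.Bool using (Bool; true; false; _∧_; _∨_; not; if_then_else_)
open import Data.Nat as ℕ using (ℕ; zero; suc; _∸_; _<ᵇ_; _≡ᵇ_)
open import Data.Integer as ℤ using (ℤ; +_; -_; _+_; _*_; _-_)
open import Data.List using (List; []; _∷_; _++_; map; concatMap; upTo; zipWith; length; filterᵇ; foldr)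
open import Data.Bool.ListAction using (any)
open import Data.Fin using (Fin; zero; suc; toℕ; punchIn)

range : ℕ → List ℕ
range k = map suc (upTo k)

interval : ℕ → ℕ → List ℕ
interval a b = map (a ℕ.+_) (upTo (b ∸ a))

insertAll : ℕ → List ℕ → List (List ℕ)
insertAll x []       = (x ∷ []) ∷ []
insertAll x (y ∷ ys) = (x ∷ y ∷ ys) ∷ map (y ∷_) (insertAll x ys)

perms : ℕ → List (List ℕ)
perms zero    = [] ∷ []
perms (suc n) = concatMap (insertAll (suc n)) (perms n)

sublists : List ℕ → List (List ℕ)
sublists []       = [] ∷ []
sublists (x ∷ xs) = map (x ∷_) (sublists xs) ++ sublists xs

_==ᵇ_ : Bool → Bool → Bool
true  ==ᵇ b = b
false ==ᵇ b = not b

orderIso : List ℕ → List ℕ → Bool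
orderIso []       []       = true
orderIso []       (_ ∷ _)  = false
orderIso (_ ∷ _)  []       = false
orderIso (a ∷ as) (b ∷ bs) =
  foldr _∧_ true
    (zipWith (λ a' b' → ((a <ᵇ a') ==ᵇ (b <ᵇ b')) ∧ ((a' <ᵇ a) ==ᵇ (b' <ᵇ b))) as bs)
  ∧ orderIso as bs

contains : List ℕ → List ℕ → Bool
contains α β = any (orderIso β) (sublists α)

avoids : List ℕ → List ℕ → Bool
avoids α β = not (contains α β)

p132 : List ℕ
p132 = 1 ∷ 3 ∷ 2 ∷ []

p213 : List ℕ
p213 = 2 ∷ 1 ∷ 3 ∷ []

countAvoiders : List ℕ → ℕ → ℕ
countAvoiders τ n =
  length (filterᵇ (λ α → avoids α p132 ∧ avoids α p213 ∧ avoids α τ) (perms n))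

PS : Set
PS = ℕ → ℤ

sumℤ : List ℤ → ℤ
sumℤ = foldr _+_ (+ 0)

0ₚ 1ₚ : PS
0ₚ n = + 0
1ₚ zero    = + 1
1ₚ (suc _) = + 0

xpow : ℕ → PS
xpow d n = if n ≡ᵇ d then + 1 else + 0

_+ₚ_ _-ₚ_ _*ₚ_ : PS → PS → PS
(a +ₚ b) n = a n + b n
(a -ₚ b) n = a n - b n
(a *ₚ b) n = sumℤ (map (λ i → a i * b (n ∸ i)) (upTo (suc n)))

-ₚ_ : PS → PS
(-ₚ a) n = - a n

headOr : ℤ → List ℤ → ℤ
headOr d []      = d
headOr _ (x ∷ _) = x

-- reversed prefix [b_n, …, b_0] of the inverse b of a series a with a_0 = 1:
-- b_0 = 1, b_n = - Σ_{k=1}^{n} a_k b_{n-k}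
invPrefix : PS → ℕ → List ℤ
invPrefix a zero    = + 1 ∷ []
invPrefix a (suc n) =
  (- sumℤ (zipWith _*_ (map (λ j → a (suc j)) (upTo (suc n))) (invPrefix a n)))
  ∷ invPrefix a n

-- multiplicative inverse of a power series with constant term 1
inv₁ : PS → PS
inv₁ a n = headOr (+ 0) (invPrefix a n)

den : ℕ → PS
den d = (1ₚ -ₚ (xpow 1 +ₚ xpow 1)) +ₚ xpow d

-- f_d(x) = (1-x)/(1-2x+x^d),  g_d(x) = x^d/(1-2x+x^d)   (d ≥ 1)
f : ℕ → PS
f d = (1ₚ -ₚ xpow 1) *ₚ inv₁ (den d)

g : ℕ → PS
g d = xpow d *ₚ inv₁ (den d)

sumFin : ∀ {n} → (Fin n → PS) → PS
sumFin {zero}  h = 0ₚ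
sumFin {suc n} h = h zero +ₚ sumFin (λ i → h (suc i))

sign : ℕ → PS → PS
sign zero          a = a
sign (suc zero)    a = -ₚ a
sign (suc (suc j)) a = sign j a

det : ∀ n → (Fin n → Fin n → PS) → PS
det zero    M = 1ₚ
det (suc n) M =
  sumFin (λ j → sign (toℕ j) (M zero j *ₚ det n (λ a b → M (suc a) (punchIn j b))))

-- The m×m matrix of the theorem, given t : Fin m → ℕ (0-based indices):
-- M_{i,0} = f_{t_i}; M_{i,i} = 1 for i ≥ 1; M_{i,i+1} = -g_{t_i}; else 0
theMatrix : ∀ m → (Fin m → ℕ) → Fin m → Fin m → PS
theMatrix m t i j =
  if toℕ j ≡ᵇ 0 then f (t i)
  else if toℕ j ≡ᵇ toℕ i then 1ₚ
  else if toℕ j ≡ᵇ suc (toℕ i) then -ₚ g (t i)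
  else 0ₚ

-- A permutation avoids 132 and 213 exactly when it is layered: a sequence of
-- blocks of consecutive increasing values, each block above all later ones.
-- Layered permutations of length n correspond to compositions of n (their
-- block lengths), and if τ corresponds to t = (t₁, …, tₘ), a layered α
-- contains τ iff some subsequence of the composition of α dominates t
-- termwise.  Sorting the compositions avoiding t by their first part gives
--   (1 - 2x + x^{t₁}) C_t(x) = (1 - x) + x^{t₁} C_{(t₂,…,tₘ)}(x),
-- that is C_t = f_{t₁} + g_{t₁} C_{(t₂,…,tₘ)}, which is also what expanding the
-- determinant along its first row produces.

module Submission where

open import Defs
open import Data.Bool using (Bool; true; false; not; _∧_; _∨_; if_then_else_; T; T?)
import Data.Bool.Properties as Bool
open import Data.Bool.ListAction using (and)
open import Data.Empty using (⊥-elim)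
open import Data.Fin using (Fin; zero; suc; toℕ; inject₁; fromℕ; punchIn)
import Data.Fin.Properties as Fin
open import Data.Integer as ℤ using (ℤ; +_; -_; _+_; _*_; _-_)
import Data.Integer.Properties as ℤ
open import Data.Integer.Tactic.RingSolver using (solve-∀)
open import Data.List using (List; []; _∷_; _++_; [_]; map; concat; concatMap; filterᵇ; length; take; drop; zipWith; upTo; applyUpTo; allFin; tabulate)
import Data.List.Properties as List
open import Data.List.Membership.Propositional using (_∈_; find; lose)
open import Data.List.Membership.Propositional.Properties using (∈-++⁺ˡ; ∈-++⁺ʳ; ∈-++⁻; ∈-map⁺; ∈-map⁻; ∈-filter⁺; ∈-∃++; ∈-insert; ∈-concatMap⁺)
open import Data.List.Relation.Binary.Permutation.Propositional using (_↭_; ↭-sym)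
open import Data.List.Relation.Binary.Permutation.Propositional.Properties using (↭-empty-inv; ∈-resp-↭; drop-mid)
open import Data.List.Relation.Binary.Sublist.Propositional using (_⊆_; []; _∷_; _∷ʳ_; ⊆-refl; ⊆-trans)
open import Data.List.Relation.Binary.Sublist.Propositional.Properties using (All-resp-⊆; take-⊆; ++⁺; length-mono-≤; []⊆-universal)
open import Data.List.Relation.Unary.All as All using (All; []; _∷_)
import Data.List.Relation.Unary.All.Properties as All
open import Data.List.Relation.Unary.AllPairs using (AllPairs; []; _∷_)
open import Data.List.Relation.Unary.Any using (here; there)
open import Data.List.Relation.Unary.Any.Properties using (any⁺; any⁻)
open import Data.Nat as ℕ using (ℕ; zero; suc; _∸_; _<_; _≤_; _≥_; _<ᵇ_; _≤ᵇ_; _≡ᵇ_; z≤n; s≤s)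
import Data.Nat.Properties as ℕ
open import Data.Nat.ListAction using (sum)
open import Data.Product using (Σ; ∃; ∃₂; _×_; _,_)
open import Data.Sum using (inj₁; inj₂)
import Algebra.Properties.CommutativeSemigroup ℕ.+-commutativeSemigroup as ℕ+
import Algebra.Properties.CommutativeSemigroup ℤ.+-commutativeSemigroup as ℤ+
open import Function using (_∘_; id; Equivalence)
open import Relation.Binary.Bundles using (Setoid)
open import Relation.Binary.PropositionalEquality hiding ([_])
import Relation.Binary.Reasoning.Setoid as SetoidReasoning
open import Relation.Nullary using (contradiction)

-- Formal power series

∑ : ℕ → (ℕ → ℤ) → ℤ
∑ zero    h = + 0
∑ (suc n) h = h 0 + ∑ n (h ∘ suc)

sumℤ-map-applyUpTo : ∀ (h : ℕ → ℤ) g n → sumℤ (map h (applyUpTo g n)) ≡ ∑ n (h ∘ g)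
sumℤ-map-applyUpTo h g zero    = refl
sumℤ-map-applyUpTo h g (suc n) = cong (_+_ (h (g 0))) (sumℤ-map-applyUpTo h (g ∘ suc) n)

∑-cong< : ∀ n {h k : ℕ → ℤ} → (∀ i → i ℕ.< n → h i ≡ k i) → ∑ n h ≡ ∑ n k
∑-cong< zero    eq = refl
∑-cong< (suc n) eq = cong₂ _+_ (eq 0 (s≤s z≤n)) (∑-cong< n (λ i i<n → eq (suc i) (s≤s i<n)))

∑-cong : ∀ n {h k : ℕ → ℤ} → h ≗ k → ∑ n h ≡ ∑ n k
∑-cong n eq = ∑-cong< n (λ i _ → eq i)

∑-zero : ∀ n {h : ℕ → ℤ} → (∀ i → h i ≡ + 0) → ∑ n h ≡ + 0
∑-zero zero    eq = refl
∑-zero (suc n) eq = cong₂ _+_ (eq 0) (∑-zero n (eq ∘ suc))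

∑-+ : ∀ n (h k : ℕ → ℤ) → ∑ n (λ i → h i + k i) ≡ ∑ n h + ∑ n k
∑-+ zero    h k = refl
∑-+ (suc n) h k = trans (cong (_+_ (h 0 + k 0)) (∑-+ n (h ∘ suc) (k ∘ suc)))
                        (ℤ+.interchange (h 0) (k 0) (∑ n (h ∘ suc)) (∑ n (k ∘ suc)))

∑-neg : ∀ n (h : ℕ → ℤ) → ∑ n (λ i → - h i) ≡ - ∑ n h
∑-neg zero    h = refl
∑-neg (suc n) h = trans (cong (_+_ (- h 0)) (∑-neg n (h ∘ suc))) (sym (ℤ.neg-distrib-+ (h 0) _))

∑-*ˡ : ∀ n c (h : ℕ → ℤ) → ∑ n (λ i → c * h i) ≡ c * ∑ n h
∑-*ˡ zero    c h = sym (ℤ.*-zeroʳ c)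
∑-*ˡ (suc n) c h = trans (cong (_+_ (c * h 0)) (∑-*ˡ n c (h ∘ suc))) (sym (ℤ.*-distribˡ-+ c (h 0) _))

∑-*ʳ : ∀ n c (h : ℕ → ℤ) → ∑ n (λ i → h i * c) ≡ ∑ n h * c
∑-*ʳ n c h = begin
  ∑ n (λ i → h i * c)  ≡⟨ ∑-cong n (λ i → ℤ.*-comm (h i) c) ⟩
  ∑ n (λ i → c * h i)  ≡⟨ ∑-*ˡ n c h ⟩
  c * ∑ n h            ≡⟨ ℤ.*-comm c _ ⟩
  ∑ n h * c            ∎
  where open ≡-Reasoning

∑-last : ∀ n (h : ℕ → ℤ) → ∑ (suc n) h ≡ ∑ n h + h n
∑-last zero    h = trans (ℤ.+-identityʳ (h 0)) (sym (ℤ.+-identityˡ (h 0)))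
∑-last (suc n) h = trans (cong (_+_ (h 0)) (∑-last n (h ∘ suc))) (sym (ℤ.+-assoc (h 0) _ (h (suc n))))

∑-reverse : ∀ n (h : ℕ → ℤ) → ∑ n h ≡ ∑ n (λ i → h (n ∸ suc i))
∑-reverse zero    h = refl
∑-reverse (suc n) h = begin
  h 0 + ∑ n (h ∘ suc)                      ≡⟨ cong (_+_ (h 0)) (∑-reverse n (h ∘ suc)) ⟩
  h 0 + ∑ n (λ i → h (suc (n ∸ suc i)))    ≡⟨ cong (_+_ (h 0)) (∑-cong< n (λ i i<n → cong h (sym (ℕ.+-∸-assoc 1 i<n)))) ⟩
  h 0 + ∑ n (λ i → h (n ∸ i))              ≡⟨ ℤ.+-comm (h 0) _ ⟩
  ∑ n (λ i → h (n ∸ i)) + h 0              ≡⟨ cong (λ j → ∑ n (λ i → h (n ∸ i)) + h j) (ℕ.n∸n≡0 n) ⟨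
  ∑ n (λ i → h (n ∸ i)) + h (n ∸ n)        ≡⟨ ∑-last n (λ i → h (n ∸ i)) ⟨
  ∑ (suc n) (λ i → h (n ∸ i))              ∎
  where open ≡-Reasoning

∑-triangle : ∀ n (F : ℕ → ℕ → ℤ) →
  ∑ (suc n) (λ i → ∑ (suc i) (λ j → F j i)) ≡ ∑ (suc n) (λ j → ∑ (suc (n ∸ j)) (λ k → F j (j ℕ.+ k)))
∑-triangle zero    F = refl
∑-triangle (suc n) F = begin
  (F 0 0 + + 0) + ∑ (suc n) (λ i → F 0 (suc i) + ∑ (suc i) (λ j → F (suc j) (suc i)))
    ≡⟨ cong (_+_ (F 0 0 + + 0)) (∑-+ (suc n) (λ i → F 0 (suc i)) (λ i → ∑ (suc i) (λ j → F (suc j) (suc i)))) ⟩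
  (F 0 0 + + 0) + (A + ∑ (suc n) (λ i → ∑ (suc i) (λ j → F (suc j) (suc i))))
    ≡⟨ cong (λ z → (F 0 0 + + 0) + (A + z)) (∑-triangle n (λ j i → F (suc j) (suc i))) ⟩
  (F 0 0 + + 0) + (A + B)
    ≡⟨ sym (ℤ.+-assoc (F 0 0 + + 0) A B) ⟩
  ((F 0 0 + + 0) + A) + B
    ≡⟨ cong (λ z → (z + A) + B) (ℤ.+-identityʳ (F 0 0)) ⟩
  (F 0 0 + A) + B ∎
  where
  open ≡-Reasoning
  A B : ℤ
  A = ∑ (suc n) (λ i → F 0 (suc i))
  B = ∑ (suc n) (λ j → ∑ (suc (n ∸ j)) (λ k → F (suc j) (suc j ℕ.+ k)))

∑-xpow : ∀ n d (h : ℕ → ℤ) → ∑ n (λ i → xpow d i * h i) ≡ (if d <ᵇ n then h d else + 0)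
∑-xpow zero    d       h = refl
∑-xpow (suc n) zero    h = begin
  + 1 * h 0 + ∑ n (λ i → + 0 * h (suc i))  ≡⟨ cong₂ _+_ (ℤ.*-identityˡ (h 0)) (∑-zero n (λ i → refl)) ⟩
  h 0 + + 0                                ≡⟨ ℤ.+-identityʳ (h 0) ⟩
  h 0                                      ∎
  where open ≡-Reasoning
∑-xpow (suc n) (suc d) h = trans (ℤ.+-identityˡ _) (∑-xpow n d (h ∘ suc))

PS-setoid : Setoid _ _
PS-setoid = ℕ →-setoid ℤ

open Setoid PS-setoid using () renaming (refl to ≗-refl; sym to ≗-sym; trans to ≗-trans)

+ₚ-cong : ∀ {a a′ b b′} → a ≗ a′ → b ≗ b′ → (a +ₚ b) ≗ (a′ +ₚ b′)
+ₚ-cong a≗a′ b≗b′ n = cong₂ _+_ (a≗a′ n) (b≗b′ n)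

*ₚ-coeff : ∀ a b n → (a *ₚ b) n ≡ ∑ (suc n) (λ i → a i * b (n ∸ i))
*ₚ-coeff a b n = sumℤ-map-applyUpTo (λ i → a i * b (n ∸ i)) id (suc n)

*ₚ-cong : ∀ {a a′ b b′} → a ≗ a′ → b ≗ b′ → (a *ₚ b) ≗ (a′ *ₚ b′)
*ₚ-cong {a} {a′} {b} {b′} a≗a′ b≗b′ n = begin
  (a *ₚ b) n                             ≡⟨ *ₚ-coeff a b n ⟩
  ∑ (suc n) (λ i → a i * b (n ∸ i))      ≡⟨ ∑-cong (suc n) (λ i → cong₂ _*_ (a≗a′ i) (b≗b′ (n ∸ i))) ⟩
  ∑ (suc n) (λ i → a′ i * b′ (n ∸ i))    ≡⟨ *ₚ-coeff a′ b′ n ⟨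
  (a′ *ₚ b′) n                           ∎
  where open ≡-Reasoning

*ₚ-congˡ : ∀ a {b b′} → b ≗ b′ → (a *ₚ b) ≗ (a *ₚ b′)
*ₚ-congˡ a = *ₚ-cong {a} (λ _ → refl)

*ₚ-congʳ : ∀ {a a′} b → a ≗ a′ → (a *ₚ b) ≗ (a′ *ₚ b)
*ₚ-congʳ b a≗a′ = *ₚ-cong a≗a′ (λ _ → refl)

*ₚ-comm : ∀ a b → (a *ₚ b) ≗ (b *ₚ a)
*ₚ-comm a b n = begin
  (a *ₚ b) n                                    ≡⟨ *ₚ-coeff a b n ⟩
  ∑ (suc n) (λ i → a i * b (n ∸ i))             ≡⟨ ∑-reverse (suc n) (λ i → a i * b (n ∸ i)) ⟩
  ∑ (suc n) (λ i → a (n ∸ i) * b (n ∸ (n ∸ i))) ≡⟨ ∑-cong< (suc n) swap ⟩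
  ∑ (suc n) (λ i → b i * a (n ∸ i))             ≡⟨ *ₚ-coeff b a n ⟨
  (b *ₚ a) n                                    ∎
  where
  open ≡-Reasoning
  swap : ∀ i → i ℕ.< suc n → a (n ∸ i) * b (n ∸ (n ∸ i)) ≡ b i * a (n ∸ i)
  swap i i<1+n = trans (ℤ.*-comm (a (n ∸ i)) _) (cong (λ j → b j * a (n ∸ i)) (ℕ.m∸[m∸n]≡n (ℕ.≤-pred i<1+n)))

*ₚ-assoc : ∀ a b c → ((a *ₚ b) *ₚ c) ≗ (a *ₚ (b *ₚ c))
*ₚ-assoc a b c n = begin
  ((a *ₚ b) *ₚ c) n
    ≡⟨ *ₚ-coeff (a *ₚ b) c n ⟩
  ∑ (suc n) (λ i → (a *ₚ b) i * c (n ∸ i))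
    ≡⟨ ∑-cong (suc n) expandˡ ⟩
  ∑ (suc n) (λ i → ∑ (suc i) (λ j → a j * (b (i ∸ j) * c (n ∸ i))))
    ≡⟨ ∑-triangle n (λ j i → a j * (b (i ∸ j) * c (n ∸ i))) ⟩
  ∑ (suc n) (λ j → ∑ (suc (n ∸ j)) (λ k → a j * (b (j ℕ.+ k ∸ j) * c (n ∸ (j ℕ.+ k)))))
    ≡⟨ ∑-cong (suc n) expandʳ ⟩
  ∑ (suc n) (λ j → a j * (b *ₚ c) (n ∸ j))
    ≡⟨ *ₚ-coeff a (b *ₚ c) n ⟨
  (a *ₚ (b *ₚ c)) n ∎
  where
  open ≡-Reasoning
  expandˡ : ∀ i → (a *ₚ b) i * c (n ∸ i) ≡ ∑ (suc i) (λ j → a j * (b (i ∸ j) * c (n ∸ i)))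
  expandˡ i = begin
    (a *ₚ b) i * c (n ∸ i)                              ≡⟨ cong (_* c (n ∸ i)) (*ₚ-coeff a b i) ⟩
    ∑ (suc i) (λ j → a j * b (i ∸ j)) * c (n ∸ i)       ≡⟨ ∑-*ʳ (suc i) (c (n ∸ i)) (λ j → a j * b (i ∸ j)) ⟨
    ∑ (suc i) (λ j → a j * b (i ∸ j) * c (n ∸ i))       ≡⟨ ∑-cong (suc i) (λ j → ℤ.*-assoc (a j) (b (i ∸ j)) (c (n ∸ i))) ⟩
    ∑ (suc i) (λ j → a j * (b (i ∸ j) * c (n ∸ i)))     ∎
  expandʳ : ∀ j → ∑ (suc (n ∸ j)) (λ k → a j * (b (j ℕ.+ k ∸ j) * c (n ∸ (j ℕ.+ k))))
                  ≡ a j * (b *ₚ c) (n ∸ j)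
  expandʳ j = begin
    ∑ (suc (n ∸ j)) (λ k → a j * (b (j ℕ.+ k ∸ j) * c (n ∸ (j ℕ.+ k))))
      ≡⟨ ∑-cong (suc (n ∸ j)) (λ k → cong₂ (λ u v → a j * (b u * c v)) (ℕ.m+n∸m≡n j k) (sym (ℕ.∸-+-assoc n j k))) ⟩
    ∑ (suc (n ∸ j)) (λ k → a j * (b k * c (n ∸ j ∸ k)))
      ≡⟨ ∑-*ˡ (suc (n ∸ j)) (a j) (λ k → b k * c (n ∸ j ∸ k)) ⟩
    a j * ∑ (suc (n ∸ j)) (λ k → b k * c (n ∸ j ∸ k))
      ≡⟨ cong (a j *_) (*ₚ-coeff b c (n ∸ j)) ⟨
    a j * (b *ₚ c) (n ∸ j) ∎

*ₚ-distribʳ-+ₚ : ∀ a b c → ((a +ₚ b) *ₚ c) ≗ ((a *ₚ c) +ₚ (b *ₚ c))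
*ₚ-distribʳ-+ₚ a b c n = begin
  ((a +ₚ b) *ₚ c) n
    ≡⟨ *ₚ-coeff (a +ₚ b) c n ⟩
  ∑ (suc n) (λ i → (a i + b i) * c (n ∸ i))
    ≡⟨ ∑-cong (suc n) (λ i → ℤ.*-distribʳ-+ (c (n ∸ i)) (a i) (b i)) ⟩
  ∑ (suc n) (λ i → a i * c (n ∸ i) + b i * c (n ∸ i))
    ≡⟨ ∑-+ (suc n) (λ i → a i * c (n ∸ i)) (λ i → b i * c (n ∸ i)) ⟩
  ∑ (suc n) (λ i → a i * c (n ∸ i)) + ∑ (suc n) (λ i → b i * c (n ∸ i))
    ≡⟨ cong₂ _+_ (*ₚ-coeff a c n) (*ₚ-coeff b c n) ⟨
  (a *ₚ c) n + (b *ₚ c) n ∎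
  where open ≡-Reasoning

*ₚ-distribˡ-+ₚ : ∀ a b c → (a *ₚ (b +ₚ c)) ≗ ((a *ₚ b) +ₚ (a *ₚ c))
*ₚ-distribˡ-+ₚ a b c n =
  trans (*ₚ-comm a (b +ₚ c) n)
        (trans (*ₚ-distribʳ-+ₚ b c a n) (cong₂ _+_ (*ₚ-comm b a n) (*ₚ-comm c a n)))

-ₚ‿*ₚ : ∀ a b → ((-ₚ a) *ₚ b) ≗ (-ₚ (a *ₚ b))
-ₚ‿*ₚ a b n = begin
  ((-ₚ a) *ₚ b) n                        ≡⟨ *ₚ-coeff (-ₚ a) b n ⟩
  ∑ (suc n) (λ i → - a i * b (n ∸ i))    ≡⟨ ∑-cong (suc n) (λ i → sym (ℤ.neg-distribˡ-* (a i) (b (n ∸ i)))) ⟩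
  ∑ (suc n) (λ i → - (a i * b (n ∸ i)))  ≡⟨ ∑-neg (suc n) (λ i → a i * b (n ∸ i)) ⟩
  - ∑ (suc n) (λ i → a i * b (n ∸ i))    ≡⟨ cong -_ (*ₚ-coeff a b n) ⟨
  - (a *ₚ b) n                           ∎
  where open ≡-Reasoning

*ₚ-distribʳ--ₚ : ∀ a b c → ((a -ₚ b) *ₚ c) ≗ ((a *ₚ c) -ₚ (b *ₚ c))
*ₚ-distribʳ--ₚ a b c n = trans (*ₚ-distribʳ-+ₚ a (-ₚ b) c n) (cong (_+_ ((a *ₚ c) n)) (-ₚ‿*ₚ b c n))

*ₚ-identityˡ : ∀ a → (1ₚ *ₚ a) ≗ a
*ₚ-identityˡ a n = begin
  (1ₚ *ₚ a) n                                       ≡⟨ *ₚ-coeff 1ₚ a n ⟩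
  + 1 * a n + ∑ n (λ i → + 0 * a (n ∸ suc i))       ≡⟨ cong₂ _+_ (ℤ.*-identityˡ (a n)) (∑-zero n (λ _ → refl)) ⟩
  a n + + 0                                         ≡⟨ ℤ.+-identityʳ (a n) ⟩
  a n                                               ∎
  where open ≡-Reasoning

*ₚ-identityʳ : ∀ a → (a *ₚ 1ₚ) ≗ a
*ₚ-identityʳ a n = trans (*ₚ-comm a 1ₚ n) (*ₚ-identityˡ a n)

*ₚ-zeroˡ : ∀ a → (0ₚ *ₚ a) ≗ 0ₚ
*ₚ-zeroˡ a n = trans (*ₚ-coeff 0ₚ a n) (∑-zero (suc n) (λ _ → refl))

*ₚ-zeroʳ : ∀ a → (a *ₚ 0ₚ) ≗ 0ₚ
*ₚ-zeroʳ a n = trans (*ₚ-comm a 0ₚ n) (*ₚ-zeroˡ a n)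

xpow-*ₚ : ∀ d a n → (xpow d *ₚ a) n ≡ (if d <ᵇ suc n then a (n ∸ d) else + 0)
xpow-*ₚ d a n = trans (*ₚ-coeff (xpow d) a n) (∑-xpow (suc n) d (λ i → a (n ∸ i)))

invPrefix≡ : ∀ a n → invPrefix a n ≡ applyUpTo (λ j → inv₁ a (n ∸ j)) (suc n)
invPrefix≡ a zero    = refl
invPrefix≡ a (suc n) = cong (inv₁ a (suc n) ∷_) (invPrefix≡ a n)

zipWith-applyUpTo : ∀ (_∙_ : ℤ → ℤ → ℤ) g h n →
  zipWith _∙_ (applyUpTo g n) (applyUpTo h n) ≡ applyUpTo (λ i → g i ∙ h i) n
zipWith-applyUpTo _∙_ g h zero    = refl
zipWith-applyUpTo _∙_ g h (suc n) = cong (g 0 ∙ h 0 ∷_) (zipWith-applyUpTo _∙_ (g ∘ suc) (h ∘ suc) n)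

inv₁-inverseʳ : ∀ a → a 0 ≡ + 1 → (a *ₚ inv₁ a) ≗ 1ₚ
inv₁-inverseʳ a a₀≡1 zero = trans (ℤ.+-identityʳ _) (cong (_* + 1) a₀≡1)
inv₁-inverseʳ a a₀≡1 (suc n) = begin
  (a *ₚ inv₁ a) (suc n)        ≡⟨ *ₚ-coeff a (inv₁ a) (suc n) ⟩
  a 0 * inv₁ a (suc n) + S     ≡⟨ cong₂ (λ u v → u * - v + S) a₀≡1 recurrence ⟩
  + 1 * - S + S                ≡⟨ cancel S ⟩
  + 0                          ∎
  where
  open ≡-Reasoning
  tail : ℕ → ℤ
  tail j = a (suc j) * inv₁ a (n ∸ j)
  S : ℤ
  S = ∑ (suc n) tail
  recurrence : sumℤ (zipWith _*_ (map (a ∘ suc) (upTo (suc n))) (invPrefix a n)) ≡ S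
  recurrence = begin
    sumℤ (zipWith _*_ (map (a ∘ suc) (upTo (suc n))) (invPrefix a n))
      ≡⟨ cong₂ (λ u v → sumℤ (zipWith _*_ u v)) (List.map-upTo (a ∘ suc) (suc n)) (invPrefix≡ a n) ⟩
    sumℤ (zipWith _*_ (applyUpTo (a ∘ suc) (suc n)) (applyUpTo (λ j → inv₁ a (n ∸ j)) (suc n)))
      ≡⟨ cong sumℤ (zipWith-applyUpTo _*_ (a ∘ suc) (λ j → inv₁ a (n ∸ j)) (suc n)) ⟩
    sumℤ (applyUpTo tail (suc n))
      ≡⟨ cong sumℤ (List.map-upTo tail (suc n)) ⟨
    sumℤ (map tail (upTo (suc n)))
      ≡⟨ sumℤ-map-applyUpTo tail id (suc n) ⟩
    S ∎
  cancel : ∀ s → + 1 * - s + s ≡ + 0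
  cancel = solve-∀

inv₁-solves : ∀ a {w b} → a 0 ≡ + 1 → (a *ₚ w) ≗ b → w ≗ (inv₁ a *ₚ b)
inv₁-solves a {w} {b} a₀≡1 a*w≗b = begin
  w                       ≈⟨ *ₚ-identityˡ w ⟨
  1ₚ *ₚ w                 ≈⟨ *ₚ-congʳ w (λ n → trans (*ₚ-comm (inv₁ a) a n) (inv₁-inverseʳ a a₀≡1 n)) ⟨
  (inv₁ a *ₚ a) *ₚ w      ≈⟨ *ₚ-assoc (inv₁ a) a w ⟩
  inv₁ a *ₚ (a *ₚ w)      ≈⟨ *ₚ-congˡ (inv₁ a) a*w≗b ⟩
  inv₁ a *ₚ b             ∎
  where open SetoidReasoning PS-setoid

-- The determinant

nestFG : List ℕ → PS
nestFG []       = 0ₚ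
nestFG (d ∷ ds) = f d +ₚ (g d *ₚ nestFG ds)

sumFin-cong : ∀ {n} {h h′ : Fin n → PS} → (∀ j → h j ≗ h′ j) → sumFin h ≗ sumFin h′
sumFin-cong {zero}  eq k = refl
sumFin-cong {suc n} eq k = cong₂ _+_ (eq zero k) (sumFin-cong (eq ∘ suc) k)

sumFin-zero : ∀ {n} {h : Fin n → PS} → (∀ j → h j ≗ 0ₚ) → sumFin h ≗ 0ₚ
sumFin-zero {zero}  eq k = refl
sumFin-zero {suc n} eq k = cong₂ _+_ (eq zero k) (sumFin-zero (eq ∘ suc) k)

sign-cong : ∀ j {a b} → a ≗ b → sign j a ≗ sign j b
sign-cong zero          eq   = eq
sign-cong (suc zero)    eq k = cong -_ (eq k)
sign-cong (suc (suc j)) eq   = sign-cong j eq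

sign-0ₚ : ∀ j → sign j 0ₚ ≗ 0ₚ
sign-0ₚ zero          k = refl
sign-0ₚ (suc zero)    k = refl
sign-0ₚ (suc (suc j))   = sign-0ₚ j

minor : ∀ {n} → (Fin (suc n) → Fin (suc n) → PS) → Fin (suc n) → Fin n → Fin n → PS
minor M j a b = M (suc a) (punchIn j b)

det-cong : ∀ n {M M′ : Fin n → Fin n → PS} → (∀ a b → M a b ≗ M′ a b) → det n M ≗ det n M′
det-cong zero    eq = ≗-refl
det-cong (suc n) eq = sumFin-cong (λ j →
  sign-cong (toℕ j) (*ₚ-cong (eq zero j) (det-cong n (λ a b → eq (suc a) (punchIn j b)))))

det-firstRow₂ : ∀ n (M : Fin (suc (suc n)) → Fin (suc (suc n)) → PS) →
  (∀ j → M zero (suc (suc j)) ≗ 0ₚ) →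
  det (suc (suc n)) M ≗ ((M zero zero *ₚ det (suc n) (minor M zero))
                          -ₚ (M zero (suc zero) *ₚ det (suc n) (minor M (suc zero))))
det-firstRow₂ n M rest k =
  cong (_+_ ((M zero zero *ₚ det (suc n) (minor M zero)) k))
       (trans (cong (_+_ (- (M zero (suc zero) *ₚ det (suc n) (minor M (suc zero))) k)) restVanishes)
              (ℤ.+-identityʳ _))
  where
  restVanishes : sumFin (λ j → sign (toℕ (suc (suc j))) (M zero (suc (suc j)) *ₚ det (suc n) (minor M (suc (suc j))))) k ≡ + 0
  restVanishes = sumFin-zero term k
    where
    term : ∀ j → sign (toℕ (suc (suc j))) (M zero (suc (suc j)) *ₚ det (suc n) (minor M (suc (suc j)))) ≗ 0ₚ
    term j = ≗-trans (sign-cong (toℕ j) (≗-trans (*ₚ-congʳ D (rest j)) (*ₚ-zeroˡ D))) (sign-0ₚ (toℕ j))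
      where
      D : PS
      D = det (suc n) (minor M (suc (suc j)))

det-zeroColumn : ∀ n (M : Fin (suc n) → Fin (suc n) → PS) → (∀ a → M a zero ≗ 0ₚ) → det (suc n) M ≗ 0ₚ
det-zeroColumn zero    M zero-col k =
  trans (ℤ.+-identityʳ _) (trans (*ₚ-congʳ 1ₚ (zero-col zero) k) (*ₚ-zeroˡ 1ₚ k))
det-zeroColumn (suc n) M zero-col = sumFin-zero term
  where
  term : ∀ j → sign (toℕ j) (M zero j *ₚ det (suc n) (minor M j)) ≗ 0ₚ
  term zero    = ≗-trans (*ₚ-congʳ (det (suc n) (minor M zero)) (zero-col zero)) (*ₚ-zeroˡ (det (suc n) (minor M zero)))
  term (suc j) = ≗-trans (sign-cong (toℕ (suc j))
                   (≗-trans (*ₚ-congˡ (M zero (suc j)) (det-zeroColumn n (minor M (suc j)) (zero-col ∘ suc))) (*ₚ-zeroʳ (M zero (suc j)))))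
                 (sign-0ₚ (toℕ (suc j)))

unitBidiagonal : ∀ {n} → (Fin n → PS) → Fin n → Fin n → PS
unitBidiagonal h a b =
  if toℕ b ≡ᵇ toℕ a then 1ₚ else if toℕ b ≡ᵇ suc (toℕ a) then h a else 0ₚ

det-unitBidiagonal : ∀ n (h : Fin n → PS) → det n (unitBidiagonal h) ≗ 1ₚ
det-unitBidiagonal zero          h   = ≗-refl
det-unitBidiagonal (suc zero)    h k = trans (ℤ.+-identityʳ _) (*ₚ-identityˡ 1ₚ k)
det-unitBidiagonal (suc (suc n)) h   = begin
  det (suc (suc n)) (unitBidiagonal h)
    ≈⟨ det-firstRow₂ n (unitBidiagonal h) (λ _ _ → refl) ⟩
  (1ₚ *ₚ det (suc n) (unitBidiagonal (h ∘ suc))) -ₚ (h zero *ₚ det (suc n) (minor (unitBidiagonal h) (suc zero)))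
    ≈⟨ (λ k → cong₂ _-_ (*ₚ-identityˡ (det (suc n) (unitBidiagonal (h ∘ suc))) k)
                           (*ₚ-congˡ (h zero) (det-zeroColumn n (minor (unitBidiagonal h) (suc zero)) (λ _ _ → refl)) k)) ⟩
  det (suc n) (unitBidiagonal (h ∘ suc)) -ₚ (h zero *ₚ 0ₚ)
    ≈⟨ (λ k → cong₂ _-_ (det-unitBidiagonal (suc n) (h ∘ suc) k) (*ₚ-zeroʳ (h zero) k)) ⟩
  1ₚ -ₚ 0ₚ
    ≈⟨ (λ k → ℤ.+-identityʳ (1ₚ k)) ⟩
  1ₚ ∎
  where open SetoidReasoning PS-setoid

-- Along the first row, the minor of f_{t₁} is unit bidiagonal and the minor
-- of -g_{t₁} is the matrix of (t₂, …, tₘ).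
det-theMatrix : ∀ m (t : Fin (suc m) → ℕ) → det (suc m) (theMatrix (suc m) t) ≗ nestFG (tabulate t)
det-theMatrix zero    t k = trans (ℤ.+-identityʳ _) (trans (*ₚ-identityʳ (f (t zero)) k)
                                  (sym (trans (cong (_+_ (f (t zero) k)) (*ₚ-zeroʳ (g (t zero)) k)) (ℤ.+-identityʳ _))))
det-theMatrix (suc m) t = begin
  det (suc (suc m)) (theMatrix (suc (suc m)) t)
    ≈⟨ det-firstRow₂ m (theMatrix (suc (suc m)) t) (λ _ _ → refl) ⟩
  (f (t zero) *ₚ det (suc m) (unitBidiagonal (λ a → -ₚ g (t (suc a)))))
    -ₚ ((-ₚ g (t zero)) *ₚ det (suc m) (minor (theMatrix (suc (suc m)) t) (suc zero)))
    ≈⟨ (λ k → cong₂ _-_ (*ₚ-congˡ (f (t zero)) (det-unitBidiagonal (suc m) (λ a → -ₚ g (t (suc a)))) k)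
                        (trans (-ₚ‿*ₚ (g (t zero)) (det (suc m) (minor (theMatrix (suc (suc m)) t) (suc zero))) k)
                               (cong -_ (*ₚ-congˡ (g (t zero)) (det-cong (suc m) minor₁≗) k)))) ⟩
  (f (t zero) *ₚ 1ₚ) -ₚ (-ₚ (g (t zero) *ₚ det (suc m) (theMatrix (suc m) (t ∘ suc))))
    ≈⟨ (λ k → cong₂ _+_ (*ₚ-identityʳ (f (t zero)) k) (ℤ.neg-involutive _)) ⟩
  f (t zero) +ₚ (g (t zero) *ₚ det (suc m) (theMatrix (suc m) (t ∘ suc)))
    ≈⟨ (λ k → cong (_+_ (f (t zero) k)) (*ₚ-congˡ (g (t zero)) (det-theMatrix m (t ∘ suc)) k)) ⟩
  nestFG (tabulate t) ∎
  where
  open SetoidReasoning PS-setoid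
  minor₁≗ : ∀ a b → minor (theMatrix (suc (suc m)) t) (suc zero) a b ≗ theMatrix (suc m) (t ∘ suc) a b
  minor₁≗ a zero    = ≗-refl
  minor₁≗ a (suc b) = ≗-refl

-- Counting compositions

𝟙 : Bool → ℕ
𝟙 true  = 1
𝟙 false = 0

count : ∀ {A : Set} → (A → Bool) → List A → ℕ
count P []       = 0
count P (x ∷ xs) = 𝟙 (P x) ℕ.+ count P xs

count-cong : ∀ {A : Set} {P Q : A → Bool} xs → (∀ x → P x ≡ Q x) → count P xs ≡ count Q xs
count-cong []       eq = refl
count-cong (x ∷ xs) eq = cong₂ ℕ._+_ (cong 𝟙 (eq x)) (count-cong xs eq)

count-++ : ∀ {A : Set} (P : A → Bool) xs ys → count P (xs ++ ys) ≡ count P xs ℕ.+ count P ys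
count-++ P []       ys = refl
count-++ P (x ∷ xs) ys = trans (cong (𝟙 (P x) ℕ.+_) (count-++ P xs ys)) (sym (ℕ.+-assoc (𝟙 (P x)) _ _))

count-add : ∀ {A : Set} (P Q R S : A → Bool) xs → (∀ x → 𝟙 (P x) ℕ.+ 𝟙 (Q x) ≡ 𝟙 (R x) ℕ.+ 𝟙 (S x)) →
  count P xs ℕ.+ count Q xs ≡ count R xs ℕ.+ count S xs
count-add P Q R S []       eq = refl
count-add P Q R S (x ∷ xs) eq = begin
  (𝟙 (P x) ℕ.+ count P xs) ℕ.+ (𝟙 (Q x) ℕ.+ count Q xs)  ≡⟨ ℕ+.interchange (𝟙 (P x)) _ _ _ ⟩
  (𝟙 (P x) ℕ.+ 𝟙 (Q x)) ℕ.+ (count P xs ℕ.+ count Q xs)  ≡⟨ cong₂ ℕ._+_ (eq x) (count-add P Q R S xs eq) ⟩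
  (𝟙 (R x) ℕ.+ 𝟙 (S x)) ℕ.+ (count R xs ℕ.+ count S xs)  ≡⟨ ℕ+.interchange (𝟙 (R x)) _ _ _ ⟩
  (𝟙 (R x) ℕ.+ count R xs) ℕ.+ (𝟙 (S x) ℕ.+ count S xs)  ∎
  where open ≡-Reasoning

count-false : ∀ {A : Set} {P : A → Bool} xs → (∀ x → P x ≡ false) → count P xs ≡ 0
count-false []       never = refl
count-false (x ∷ xs) never = cong₂ ℕ._+_ (cong 𝟙 (never x)) (count-false xs never)

count-map : ∀ {A B : Set} (P : B → Bool) (h : A → B) xs → count P (map h xs) ≡ count (P ∘ h) xs
count-map P h []       = refl
count-map P h (x ∷ xs) = cong (𝟙 (P (h x)) ℕ.+_) (count-map P h xs)

count-filterᵇ : ∀ {A : Set} (P R : A → Bool) xs → count P (filterᵇ R xs) ≡ count (λ x → R x ∧ P x) xs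
count-filterᵇ P R []       = refl
count-filterᵇ P R (x ∷ xs) with R x
... | true  = cong (𝟙 (P x) ℕ.+_) (count-filterᵇ P R xs)
... | false = count-filterᵇ P R xs

length-filterᵇ : ∀ {A : Set} (P : A → Bool) xs → length (filterᵇ P xs) ≡ count P xs
length-filterᵇ P []       = refl
length-filterᵇ P (x ∷ xs) with P x
... | true  = cong suc (length-filterᵇ P xs)
... | false = length-filterᵇ P xs

-- Every composition of n + 1 arises from exactly one composition of n,
-- either by prepending a part 1 or by increasing the first part.
extend : List ℕ → List (List ℕ)
extend []      = [ 1 ∷ [] ]
extend (a ∷ r) = (1 ∷ a ∷ r) ∷ (suc a ∷ r) ∷ []

compositions : ℕ → List (List ℕ)
compositions zero    = [ [] ]
compositions (suc n) = concatMap extend (compositions n)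

countComp : (List ℕ → Bool) → ℕ → ℕ
countComp P n = count P (compositions n)

onBumped : (List ℕ → Bool) → List ℕ → Bool
onBumped P []      = false
onBumped P (a ∷ r) = P (suc a ∷ r)

nonEmpty : (List ℕ → Bool) → List ℕ → Bool
nonEmpty P []      = false
nonEmpty P (a ∷ r) = P (a ∷ r)

startsWith : ℕ → (List ℕ → Bool) → List ℕ → Bool
startsWith d P []      = false
startsWith d P (a ∷ r) = (a ≡ᵇ d) ∧ P r

count-concatMap-extend : ∀ P cs →
  count P (concatMap extend cs) ≡ count (P ∘ (1 ∷_)) cs ℕ.+ count (onBumped P) cs
count-concatMap-extend P []       = refl
count-concatMap-extend P (c ∷ cs) = begin
  count P (extend c ++ concatMap extend cs)
    ≡⟨ count-++ P (extend c) (concatMap extend cs) ⟩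
  count P (extend c) ℕ.+ count P (concatMap extend cs)
    ≡⟨ cong₂ ℕ._+_ (count-extend c) (count-concatMap-extend P cs) ⟩
  (𝟙 (P (1 ∷ c)) ℕ.+ 𝟙 (onBumped P c)) ℕ.+ (count (P ∘ (1 ∷_)) cs ℕ.+ count (onBumped P) cs)
    ≡⟨ ℕ+.interchange (𝟙 (P (1 ∷ c))) _ _ _ ⟩
  count (P ∘ (1 ∷_)) (c ∷ cs) ℕ.+ count (onBumped P) (c ∷ cs) ∎
  where
  open ≡-Reasoning
  count-extend : ∀ c → count P (extend c) ≡ 𝟙 (P (1 ∷ c)) ℕ.+ 𝟙 (onBumped P c)
  count-extend []      = refl
  count-extend (a ∷ r) = cong (𝟙 (P (1 ∷ a ∷ r)) ℕ.+_) (ℕ.+-identityʳ _)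

countComp-suc : ∀ P n → countComp P (suc n) ≡ countComp (P ∘ (1 ∷_)) n ℕ.+ countComp (onBumped P) n
countComp-suc P n = count-concatMap-extend P (compositions n)

countComp-cong : ∀ {P Q} n → (∀ c → P c ≡ Q c) → countComp P n ≡ countComp Q n
countComp-cong n = count-cong (compositions n)

countComp-startsWith-zero : ∀ P n → countComp (startsWith 0 P) n ≡ 0
countComp-startsWith-zero P zero    = refl
countComp-startsWith-zero P (suc n) = trans (countComp-suc (startsWith 0 P) n)
  (cong₂ ℕ._+_ (count-false (compositions n) (λ _ → refl)) (count-false (compositions n) bumped))
  where
  bumped : ∀ c → onBumped (startsWith 0 P) c ≡ false
  bumped []      = refl
  bumped (a ∷ r) = refl

countComp-nonEmpty : ∀ P n → P [] ≡ true → countComp (nonEmpty P) n ℕ.+ 𝟙 (n ≡ᵇ 0) ≡ countComp P n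
countComp-nonEmpty P zero    P[] = cong (λ b → 𝟙 b ℕ.+ 0) (sym P[])
countComp-nonEmpty P (suc n) P[] = begin
  countComp (nonEmpty P) (suc n) ℕ.+ 0
    ≡⟨ ℕ.+-identityʳ _ ⟩
  countComp (nonEmpty P) (suc n)
    ≡⟨ countComp-suc (nonEmpty P) n ⟩
  countComp (P ∘ (1 ∷_)) n ℕ.+ countComp (onBumped (nonEmpty P)) n
    ≡⟨ cong (countComp (P ∘ (1 ∷_)) n ℕ.+_) (countComp-cong n bumped) ⟩
  countComp (P ∘ (1 ∷_)) n ℕ.+ countComp (onBumped P) n
    ≡⟨ countComp-suc P n ⟨
  countComp P (suc n) ∎
  where
  open ≡-Reasoning
  bumped : ∀ c → onBumped (nonEmpty P) c ≡ onBumped P c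
  bumped []      = refl
  bumped (a ∷ r) = refl

gf : (List ℕ → Bool) → PS
gf P n = + countComp P n

gf-startsWith : ∀ e P → gf (startsWith (suc e) P) ≗ (xpow (suc e) *ₚ gf P)
gf-startsWith e P n = trans (first-part e n) (sym (xpow-*ₚ (suc e) (gf P) n))
  where
  first-part : ∀ e n → gf (startsWith (suc e) P) n ≡ (if suc e <ᵇ suc n then gf P (n ∸ suc e) else + 0)
  first-part e       zero    = refl
  first-part zero    (suc n) = cong +_ (begin
    countComp (startsWith 1 P) (suc n)
      ≡⟨ countComp-suc (startsWith 1 P) n ⟩
    countComp (startsWith 1 P ∘ (1 ∷_)) n ℕ.+ countComp (onBumped (startsWith 1 P)) n
      ≡⟨ cong (countComp P n ℕ.+_) (trans (countComp-cong n bumped) (countComp-startsWith-zero P n)) ⟩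
    countComp P n ℕ.+ 0
      ≡⟨ ℕ.+-identityʳ _ ⟩
    countComp P n ∎)
    where
    open ≡-Reasoning
    bumped : ∀ c → onBumped (startsWith 1 P) c ≡ startsWith 0 P c
    bumped []      = refl
    bumped (a ∷ r) = refl
  first-part (suc e) (suc n) = trans (cong +_ (trans (countComp-suc (startsWith (suc (suc e)) P) n)
    (cong₂ ℕ._+_ (count-false (compositions n) (λ _ → refl)) (countComp-cong n bumped))))
    (first-part e n)
    where
    bumped : ∀ c → onBumped (startsWith (suc (suc e)) P) c ≡ startsWith (suc e) P c
    bumped []      = refl
    bumped (a ∷ r) = refl

-- Compositions avoiding a dominated subsequence

embeds : List ℕ → List ℕ → Bool
embeds []      c       = true
embeds (d ∷ t) []      = false
embeds (d ∷ t) (a ∷ r) = embeds (d ∷ t) r ∨ ((d ≤ᵇ a) ∧ embeds t r)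

avoidsᶜ : List ℕ → List ℕ → Bool
avoidsᶜ t c = not (embeds t c)

embeds-tail : ∀ d t c → embeds (d ∷ t) c ≡ true → embeds t c ≡ true
embeds-tail d []       c       _ = refl
embeds-tail d (d′ ∷ t) []      ()
embeds-tail d (d′ ∷ t) (a ∷ r) h with embeds (d ∷ d′ ∷ t) r in eq
... | true  = cong (_∨ ((d′ ≤ᵇ a) ∧ embeds t r)) (embeds-tail d (d′ ∷ t) r eq)
... | false = cong (_∨ ((d′ ≤ᵇ a) ∧ embeds t r)) (Bool.∧-conicalʳ (d ≤ᵇ a) (embeds (d′ ∷ t) r) h)

-- Raising a part from a to a + 1 can create an embedding of d ∷ t only when
-- a + 1 = d, and it does so exactly when the rest embeds t but not d ∷ t.
bump-identity : ∀ a e (X Y : Bool) → (X ≡ true → Y ≡ true) →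
  𝟙 (not (X ∨ ((suc e ≤ᵇ suc a) ∧ Y))) ℕ.+ 𝟙 ((a ≡ᵇ e) ∧ not X)
    ≡ 𝟙 (not (X ∨ ((suc e ≤ᵇ a) ∧ Y))) ℕ.+ 𝟙 ((a ≡ᵇ e) ∧ not Y)
bump-identity zero    zero    true  true  X⇒Y = refl
bump-identity zero    zero    true  false X⇒Y with () ← X⇒Y refl
bump-identity zero    zero    false true  X⇒Y = refl
bump-identity zero    zero    false false X⇒Y = refl
bump-identity zero    (suc e) X     Y     X⇒Y = refl
bump-identity (suc a) zero    X     Y     X⇒Y = refl
bump-identity (suc a) (suc e) X     Y     X⇒Y = bump-identity a e X Y X⇒Y

xpow-1-suc : ∀ n → xpow 1 (suc n) ≡ + 𝟙 (n ≡ᵇ 0)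
xpow-1-suc zero    = refl
xpow-1-suc (suc n) = refl

den-*ₚ-coeff : ∀ d w n → (den d *ₚ w) n ≡ (w n - ((xpow 1 *ₚ w) n ℤ.+ (xpow 1 *ₚ w) n)) ℤ.+ (xpow d *ₚ w) n
den-*ₚ-coeff d w n = begin
  (den d *ₚ w) n
    ≡⟨ *ₚ-distribʳ-+ₚ (1ₚ -ₚ (xpow 1 +ₚ xpow 1)) (xpow d) w n ⟩
  ((1ₚ -ₚ (xpow 1 +ₚ xpow 1)) *ₚ w) n ℤ.+ (xpow d *ₚ w) n
    ≡⟨ cong (ℤ._+ (xpow d *ₚ w) n) (*ₚ-distribʳ--ₚ 1ₚ (xpow 1 +ₚ xpow 1) w n) ⟩
  ((1ₚ *ₚ w) n - ((xpow 1 +ₚ xpow 1) *ₚ w) n) ℤ.+ (xpow d *ₚ w) n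
    ≡⟨ cong (ℤ._+ (xpow d *ₚ w) n) (cong₂ _-_ (*ₚ-identityˡ w n) (*ₚ-distribʳ-+ₚ (xpow 1) (xpow 1) w n)) ⟩
  (w n - ((xpow 1 *ₚ w) n ℤ.+ (xpow 1 *ₚ w) n)) ℤ.+ (xpow d *ₚ w) n ∎
  where open ≡-Reasoning

-- The coefficient of x^{n+1} in (1 - 2x + x^d) w = (1 - x) + x^d w′.
second-difference : ∀ (w₁ w₀ h h′ ne δ : ℤ) → w₁ ℤ.+ h ≡ (w₀ ℤ.+ ne) ℤ.+ h′ → ne ℤ.+ δ ≡ w₀ →
  (w₁ - (w₀ ℤ.+ w₀)) ℤ.+ h ≡ (+ 0 - δ) ℤ.+ h′
second-difference w₁ _ h h′ ne δ eq refl = begin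
  (w₁ - (w₀ ℤ.+ w₀)) ℤ.+ h              ≡⟨ regroup w₁ w₀ h ⟩
  (w₁ ℤ.+ h) - (w₀ ℤ.+ w₀)              ≡⟨ cong (_- (w₀ ℤ.+ w₀)) eq ⟩
  ((w₀ ℤ.+ ne) ℤ.+ h′) - (w₀ ℤ.+ w₀)    ≡⟨ cancel ne δ h′ ⟩
  (+ 0 - δ) ℤ.+ h′                      ∎
  where
  open ≡-Reasoning
  w₀ : ℤ
  w₀ = ne ℤ.+ δ
  regroup : ∀ a b c → (a - (b ℤ.+ b)) ℤ.+ c ≡ (a ℤ.+ c) - (b ℤ.+ b)
  regroup = solve-∀
  cancel : ∀ a b c → (((a ℤ.+ b) ℤ.+ a) ℤ.+ c) - ((a ℤ.+ b) ℤ.+ (a ℤ.+ b)) ≡ (+ 0 - b) ℤ.+ c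
  cancel = solve-∀

module _ (e : ℕ) (t : List ℕ) where

  private
    dt : List ℕ
    dt = suc e ∷ t

  avoidsᶜ-recurrence : ∀ n →
    countComp (avoidsᶜ dt) (suc n) ℕ.+ countComp (startsWith (suc e) (avoidsᶜ dt)) (suc n)
      ≡ (countComp (avoidsᶜ dt) n ℕ.+ countComp (nonEmpty (avoidsᶜ dt)) n) ℕ.+ countComp (startsWith (suc e) (avoidsᶜ t)) (suc n)
  avoidsᶜ-recurrence n = begin
    countComp (avoidsᶜ dt) (suc n) ℕ.+ countComp (startsWith (suc e) (avoidsᶜ dt)) (suc n)
      ≡⟨ cong₂ ℕ._+_ (countComp-suc (avoidsᶜ dt) n) (countComp-suc (startsWith (suc e) (avoidsᶜ dt)) n) ⟩
    (A ℕ.+ X) ℕ.+ (B dt ℕ.+ H dt)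
      ≡⟨ ℕ+.interchange A X (B dt) (H dt) ⟩
    (A ℕ.+ B dt) ℕ.+ (X ℕ.+ H dt)
      ≡⟨ cong₂ ℕ._+_ (count-add _ _ _ _ (compositions n) prepend) (count-add _ _ _ _ (compositions n) bump) ⟩
    (W ℕ.+ B t) ℕ.+ (N ℕ.+ H t)
      ≡⟨ ℕ+.interchange W (B t) N (H t) ⟩
    (W ℕ.+ N) ℕ.+ (B t ℕ.+ H t)
      ≡⟨ cong ((W ℕ.+ N) ℕ.+_) (countComp-suc (startsWith (suc e) (avoidsᶜ t)) n) ⟨
    (W ℕ.+ N) ℕ.+ countComp (startsWith (suc e) (avoidsᶜ t)) (suc n) ∎
    where
    open ≡-Reasoning
    A X W N : ℕ
    A = countComp (avoidsᶜ dt ∘ (1 ∷_)) n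
    X = countComp (onBumped (avoidsᶜ dt)) n
    W = countComp (avoidsᶜ dt) n
    N = countComp (nonEmpty (avoidsᶜ dt)) n
    B H : List ℕ → ℕ
    B s = countComp (startsWith (suc e) (avoidsᶜ s) ∘ (1 ∷_)) n
    H s = countComp (onBumped (startsWith (suc e) (avoidsᶜ s))) n
    prepend : ∀ c → 𝟙 (avoidsᶜ dt (1 ∷ c)) ℕ.+ 𝟙 (startsWith (suc e) (avoidsᶜ dt) (1 ∷ c))
                    ≡ 𝟙 (avoidsᶜ dt c) ℕ.+ 𝟙 (startsWith (suc e) (avoidsᶜ t) (1 ∷ c))
    prepend c = trans (bump-identity 0 e (embeds dt c) (embeds t c) (embeds-tail (suc e) t c))
                      (cong (λ b → 𝟙 (not b) ℕ.+ 𝟙 ((0 ≡ᵇ e) ∧ not (embeds t c))) (Bool.∨-identityʳ (embeds dt c)))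
    bump : ∀ c → 𝟙 (onBumped (avoidsᶜ dt) c) ℕ.+ 𝟙 (onBumped (startsWith (suc e) (avoidsᶜ dt)) c)
                 ≡ 𝟙 (nonEmpty (avoidsᶜ dt) c) ℕ.+ 𝟙 (onBumped (startsWith (suc e) (avoidsᶜ t)) c)
    bump []      = refl
    bump (a ∷ r) = bump-identity a e (embeds dt r) (embeds t r) (embeds-tail (suc e) t r)

  den-*ₚ-gf-avoidsᶜ : (den (suc e) *ₚ gf (avoidsᶜ dt)) ≗ ((1ₚ -ₚ xpow 1) +ₚ (xpow (suc e) *ₚ gf (avoidsᶜ t)))
  den-*ₚ-gf-avoidsᶜ zero    = refl
  den-*ₚ-gf-avoidsᶜ (suc n) = begin
    (den (suc e) *ₚ w) (suc n)
      ≡⟨ den-*ₚ-coeff (suc e) w (suc n) ⟩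
    (w (suc n) - ((xpow 1 *ₚ w) (suc n) ℤ.+ (xpow 1 *ₚ w) (suc n))) ℤ.+ (xpow (suc e) *ₚ w) (suc n)
      ≡⟨ cong₂ (λ u v → (w (suc n) - (u ℤ.+ u)) ℤ.+ v) (xpow-*ₚ 1 w (suc n)) (sym (gf-startsWith e (avoidsᶜ dt) (suc n))) ⟩
    (w (suc n) - (w n ℤ.+ w n)) ℤ.+ gf (startsWith (suc e) (avoidsᶜ dt)) (suc n)
      ≡⟨ second-difference (+ W₁) (+ W₀) (+ Hᵀ) (+ Hᵗ) (+ N) (+ 𝟙 (n ≡ᵇ 0)) recurrenceℤ nonEmptyℤ ⟩
    (+ 0 - + 𝟙 (n ≡ᵇ 0)) ℤ.+ gf (startsWith (suc e) (avoidsᶜ t)) (suc n)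
      ≡⟨ cong₂ (λ u v → (+ 0 - u) ℤ.+ v) (xpow-1-suc n) (sym (gf-startsWith e (avoidsᶜ t) (suc n))) ⟨
    ((1ₚ -ₚ xpow 1) +ₚ (xpow (suc e) *ₚ gf (avoidsᶜ t))) (suc n) ∎
    where
    open ≡-Reasoning
    w : PS
    w = gf (avoidsᶜ dt)
    W₁ W₀ N Hᵀ Hᵗ : ℕ
    W₁ = countComp (avoidsᶜ dt) (suc n)
    W₀ = countComp (avoidsᶜ dt) n
    N  = countComp (nonEmpty (avoidsᶜ dt)) n
    Hᵀ = countComp (startsWith (suc e) (avoidsᶜ dt)) (suc n)
    Hᵗ = countComp (startsWith (suc e) (avoidsᶜ t)) (suc n)
    recurrenceℤ : + W₁ ℤ.+ + Hᵀ ≡ (+ W₀ ℤ.+ + N) ℤ.+ + Hᵗ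
    recurrenceℤ = begin
      + W₁ ℤ.+ + Hᵀ           ≡⟨ ℤ.pos-+ W₁ Hᵀ ⟨
      + (W₁ ℕ.+ Hᵀ)           ≡⟨ cong +_ (avoidsᶜ-recurrence n) ⟩
      + ((W₀ ℕ.+ N) ℕ.+ Hᵗ)   ≡⟨ ℤ.pos-+ (W₀ ℕ.+ N) Hᵗ ⟩
      + (W₀ ℕ.+ N) ℤ.+ + Hᵗ   ≡⟨ cong (ℤ._+ + Hᵗ) (ℤ.pos-+ W₀ N) ⟩
      (+ W₀ ℤ.+ + N) ℤ.+ + Hᵗ ∎
    nonEmptyℤ : + N ℤ.+ + 𝟙 (n ≡ᵇ 0) ≡ + W₀
    nonEmptyℤ = trans (sym (ℤ.pos-+ N (𝟙 (n ≡ᵇ 0)))) (cong +_ (countComp-nonEmpty (avoidsᶜ dt) n refl))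

gf-avoidsᶜ-∷ : ∀ e t → gf (avoidsᶜ (suc e ∷ t)) ≗ (f (suc e) +ₚ (g (suc e) *ₚ gf (avoidsᶜ t)))
gf-avoidsᶜ-∷ e t = begin
  gf (avoidsᶜ (suc e ∷ t))
    ≈⟨ inv₁-solves (den (suc e)) refl (den-*ₚ-gf-avoidsᶜ e t) ⟩
  I *ₚ ((1ₚ -ₚ xpow 1) +ₚ (xpow (suc e) *ₚ w))
    ≈⟨ *ₚ-distribˡ-+ₚ I (1ₚ -ₚ xpow 1) (xpow (suc e) *ₚ w) ⟩
  (I *ₚ (1ₚ -ₚ xpow 1)) +ₚ (I *ₚ (xpow (suc e) *ₚ w))
    ≈⟨ +ₚ-cong (*ₚ-comm I (1ₚ -ₚ xpow 1)) (≗-trans (≗-sym (*ₚ-assoc I (xpow (suc e)) w)) (*ₚ-congʳ w (*ₚ-comm I (xpow (suc e))))) ⟩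
  f (suc e) +ₚ (g (suc e) *ₚ w) ∎
  where
  open SetoidReasoning PS-setoid
  I w : PS
  I = inv₁ (den (suc e))
  w = gf (avoidsᶜ t)

gf-avoidsᶜ≗nestFG : ∀ t → All (0 <_) t → gf (avoidsᶜ t) ≗ nestFG t
gf-avoidsᶜ≗nestFG []          []           n = cong +_ (count-false (compositions n) (λ _ → refl))
gf-avoidsᶜ≗nestFG (suc e ∷ t) (s≤s z≤n ∷ t⁺) =
  ≗-trans (gf-avoidsᶜ-∷ e t) (+ₚ-cong {f (suc e)} (λ _ → refl) (*ₚ-congˡ (g (suc e)) (gf-avoidsᶜ≗nestFG t t⁺)))

-- Pattern containment

T⇒≡ : ∀ {b} → T b → b ≡ true
T⇒≡ = Equivalence.to Bool.T-≡

≡⇒T : ∀ {b} → b ≡ true → T b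
≡⇒T = Equivalence.from Bool.T-≡

Increasing : List ℕ → Set
Increasing = AllPairs _<_

infix 4 _≫_
_≫_ : List ℕ → List ℕ → Set
X ≫ Y = All (λ x → All (_< x) Y) X

Increasing-⊆ : ∀ {s X} → s ⊆ X → Increasing X → Increasing s
Increasing-⊆ []          []          = []
Increasing-⊆ (x ∷ʳ s⊆X)  (_ ∷ X↑)    = Increasing-⊆ s⊆X X↑
Increasing-⊆ (refl ∷ s⊆X) (x< ∷ X↑)  = All-resp-⊆ s⊆X x< ∷ Increasing-⊆ s⊆X X↑

≫-⊆ : ∀ {s₁ s₂ X Y} → s₁ ⊆ X → s₂ ⊆ Y → X ≫ Y → s₁ ≫ s₂
≫-⊆ s₁⊆X s₂⊆Y X≫Y = All-resp-⊆ s₁⊆X (All.map (All-resp-⊆ s₂⊆Y) X≫Y)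

⊆-++⁻ : ∀ X Y {s} → s ⊆ X ++ Y → ∃₂ λ (s₁ s₂ : List ℕ) → s ≡ s₁ ++ s₂ × s₁ ⊆ X × s₂ ⊆ Y
⊆-++⁻ []      Y s⊆Y = [] , _ , refl , [] , s⊆Y
⊆-++⁻ (x ∷ X) Y (.x ∷ʳ s⊆) with ⊆-++⁻ X Y s⊆
... | s₁ , s₂ , refl , s₁⊆X , s₂⊆Y = s₁ , s₂ , refl , x ∷ʳ s₁⊆X , s₂⊆Y
⊆-++⁻ (x ∷ X) Y (refl ∷ s⊆) with ⊆-++⁻ X Y s⊆
... | s₁ , s₂ , refl , s₁⊆X , s₂⊆Y = x ∷ s₁ , s₂ , refl , refl ∷ s₁⊆X , s₂⊆Y

∈-sublists⁺ : ∀ {s α} → s ⊆ α → s ∈ sublists α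
∈-sublists⁺ []                     = here refl
∈-sublists⁺ {α = x ∷ α} (.x ∷ʳ s⊆α) = ∈-++⁺ʳ (map (x ∷_) (sublists α)) (∈-sublists⁺ s⊆α)
∈-sublists⁺ (refl ∷ s⊆α)           = ∈-++⁺ˡ (∈-map⁺ _ (∈-sublists⁺ s⊆α))

∈-sublists⁻ : ∀ α {s} → s ∈ sublists α → s ⊆ α
∈-sublists⁻ []      (here refl) = []
∈-sublists⁻ (x ∷ α) s∈ with ∈-++⁻ (map (x ∷_) (sublists α)) s∈
... | inj₂ s∈′ = x ∷ʳ ∈-sublists⁻ α s∈′
... | inj₁ s∈′ with ∈-map⁻ (x ∷_) s∈′
... | s′ , s′∈ , refl = refl ∷ ∈-sublists⁻ α s′∈

contains⁺ : ∀ {α β s} → s ⊆ α → orderIso β s ≡ true → contains α β ≡ true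
contains⁺ {β = β} s⊆α iso = T⇒≡ (any⁺ (orderIso β) (lose (∈-sublists⁺ s⊆α) (≡⇒T iso)))

contains⁻ : ∀ α β → contains α β ≡ true → ∃ λ s → s ⊆ α × orderIso β s ≡ true
contains⁻ α β h with find (any⁻ (orderIso β) (sublists α) (≡⇒T h))
... | s , s∈ , iso = s , ∈-sublists⁻ α s∈ , T⇒≡ iso

contains-⊆ : ∀ {α γ} β → α ⊆ γ → contains α β ≡ true → contains γ β ≡ true
contains-⊆ {α} β α⊆γ h with contains⁻ α β h
... | s , s⊆α , iso = contains⁺ {β = β} (⊆-trans s⊆α α⊆γ) iso

compatible : ℕ → ℕ → ℕ → ℕ → Bool
compatible p s p′ s′ = ((p <ᵇ p′) ==ᵇ (s <ᵇ s′)) ∧ ((p′ <ᵇ p) ==ᵇ (s′ <ᵇ s))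

<ᵇ-true : ∀ {m n} → m < n → (m <ᵇ n) ≡ true
<ᵇ-true m<n = T⇒≡ (ℕ.<⇒<ᵇ m<n)

<ᵇ-false : ∀ {m n} → n ≤ m → (m <ᵇ n) ≡ false
<ᵇ-false {m} {n} n≤m with m <ᵇ n in eq
... | false = refl
... | true  = ⊥-elim (ℕ.≤⇒≯ n≤m (ℕ.<ᵇ⇒< m n (≡⇒T eq)))

<ᵇ-sound : ∀ m n → (m <ᵇ n) ≡ true → m < n
<ᵇ-sound m n h = ℕ.<ᵇ⇒< m n (≡⇒T h)

==ᵇ-true : ∀ u → (u ==ᵇ true) ≡ true → u ≡ true
==ᵇ-true true _ = refl

compatible-<⁻ : ∀ p s p′ s′ → s < s′ → compatible p s p′ s′ ≡ true → p < p′
compatible-<⁻ p s p′ s′ s<s′ h rewrite <ᵇ-true s<s′ =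
  <ᵇ-sound p p′ (==ᵇ-true (p <ᵇ p′) (Bool.∧-conicalˡ _ _ h))

compatible->⁻ : ∀ p s p′ s′ → s′ < s → compatible p s p′ s′ ≡ true → p′ < p
compatible->⁻ p s p′ s′ s′<s h rewrite <ᵇ-true s′<s =
  <ᵇ-sound p′ p (==ᵇ-true (p′ <ᵇ p) (Bool.∧-conicalʳ _ _ h))

compatible-<⁺ : ∀ p s p′ s′ → p < p′ → s < s′ → compatible p s p′ s′ ≡ true
compatible-<⁺ p s p′ s′ p<p′ s<s′
  rewrite <ᵇ-true p<p′ | <ᵇ-true s<s′ | <ᵇ-false (ℕ.<⇒≤ p<p′) | <ᵇ-false (ℕ.<⇒≤ s<s′) = refl

compatible->⁺ : ∀ p s p′ s′ → p′ < p → s′ < s → compatible p s p′ s′ ≡ true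
compatible->⁺ p s p′ s′ p′<p s′<s
  rewrite <ᵇ-true p′<p | <ᵇ-true s′<s | <ᵇ-false (ℕ.<⇒≤ p′<p) | <ᵇ-false (ℕ.<⇒≤ s′<s) = refl

orderIso-length : ∀ β σ → orderIso β σ ≡ true → length β ≡ length σ
orderIso-length []      []      _ = refl
orderIso-length (p ∷ β) (s ∷ σ) h = cong suc (orderIso-length β σ (Bool.∧-conicalʳ _ _ h))

module _ (c : ℕ → ℕ → Bool) where

  and-zipWith-++ : ∀ xs xs′ ys ys′ → length xs ≡ length ys →
    and (zipWith c (xs ++ xs′) (ys ++ ys′)) ≡ and (zipWith c xs ys) ∧ and (zipWith c xs′ ys′)
  and-zipWith-++ []       xs′ []       ys′ _   = refl
  and-zipWith-++ (x ∷ xs) xs′ (y ∷ ys) ys′ len =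
    trans (cong (c x y ∧_) (and-zipWith-++ xs xs′ ys ys′ (ℕ.suc-injective len))) (sym (Bool.∧-assoc (c x y) _ _))

  and-zipWith⁻ : ∀ {P Q : ℕ → Set} xs ys → length xs ≡ length ys → and (zipWith c xs ys) ≡ true →
    All Q ys → (∀ x y → Q y → c x y ≡ true → P x) → All P xs
  and-zipWith⁻ []       []       _   _ _        _ = []
  and-zipWith⁻ (x ∷ xs) (y ∷ ys) len h (qy ∷ qs) k =
    k x y qy (Bool.∧-conicalˡ _ _ h) ∷ and-zipWith⁻ xs ys (ℕ.suc-injective len) (Bool.∧-conicalʳ _ _ h) qs k

  and-zipWith⁺ : ∀ {P Q : ℕ → Set} xs ys → All P xs → All Q ys →
    (∀ x y → P x → Q y → c x y ≡ true) → and (zipWith c xs ys) ≡ true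
  and-zipWith⁺ []       ys       _         _         k = refl
  and-zipWith⁺ (x ∷ xs) []       _         _         k = refl
  and-zipWith⁺ (x ∷ xs) (y ∷ ys) (px ∷ ps) (qy ∷ qs) k = cong₂ _∧_ (k x y px qy) (and-zipWith⁺ xs ys ps qs k)

record IsoSplit (β σ₁ σ₂ : List ℕ) : Set where
  field
    β₁ β₂   : List ℕ
    β≡      : β ≡ β₁ ++ β₂
    length≡ : length β₁ ≡ length σ₁
    β₁↑     : Increasing β₁
    β₁≫β₂   : β₁ ≫ β₂
    iso₂    : orderIso β₂ σ₂ ≡ true

orderIso-++⁻ : ∀ σ₁ σ₂ β → Increasing σ₁ → σ₁ ≫ σ₂ → orderIso β (σ₁ ++ σ₂) ≡ true → IsoSplit β σ₁ σ₂
orderIso-++⁻ []       σ₂ β       _           _            h = record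
  { β₁ = [] ; β₂ = β ; β≡ = refl ; length≡ = refl ; β₁↑ = [] ; β₁≫β₂ = [] ; iso₂ = h }
orderIso-++⁻ (s ∷ σ₁) σ₂ (p ∷ β) (s< ∷ σ₁↑) (s> ∷ σ₁≫σ₂) h
  with orderIso-++⁻ σ₁ σ₂ β σ₁↑ σ₁≫σ₂ (Bool.∧-conicalʳ _ _ h)
... | record { β₁ = β₁ ; β₂ = β₂ ; β≡ = refl ; length≡ = len ; β₁↑ = β₁↑ ; β₁≫β₂ = β₁≫β₂ ; iso₂ = iso₂ } = record
  { β₁ = p ∷ β₁ ; β₂ = β₂ ; β≡ = refl ; length≡ = cong suc len
  ; β₁↑ = above ∷ β₁↑ ; β₁≫β₂ = below ∷ β₁≫β₂ ; iso₂ = iso₂ }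
  where
  both : and (zipWith (compatible p s) β₁ σ₁) ∧ and (zipWith (compatible p s) β₂ σ₂) ≡ true
  both = trans (sym (and-zipWith-++ (compatible p s) β₁ β₂ σ₁ σ₂ len)) (Bool.∧-conicalˡ _ _ h)
  above : All (p <_) β₁
  above = and-zipWith⁻ (compatible p s) β₁ σ₁ len (Bool.∧-conicalˡ _ _ both) s<
            (λ p′ s′ s<s′ → compatible-<⁻ p s p′ s′ s<s′)
  below : All (_< p) β₂
  below = and-zipWith⁻ (compatible p s) β₂ σ₂ (orderIso-length β₂ σ₂ iso₂) (Bool.∧-conicalʳ _ _ both) s>
            (λ p′ s′ s′<s → compatible->⁻ p s p′ s′ s′<s)

orderIso-++⁺ : ∀ β₁ β₂ σ₁ σ₂ → length β₁ ≡ length σ₁ → Increasing β₁ → Increasing σ₁ →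
  β₁ ≫ β₂ → σ₁ ≫ σ₂ → orderIso β₂ σ₂ ≡ true → orderIso (β₁ ++ β₂) (σ₁ ++ σ₂) ≡ true
orderIso-++⁺ []       β₂ []       σ₂ _   _            _            _            _            iso = iso
orderIso-++⁺ (p ∷ β₁) β₂ (s ∷ σ₁) σ₂ len (p< ∷ β₁↑) (s< ∷ σ₁↑) (p> ∷ β₁≫β₂) (s> ∷ σ₁≫σ₂) iso =
  cong₂ _∧_
    (trans (and-zipWith-++ (compatible p s) β₁ β₂ σ₁ σ₂ (ℕ.suc-injective len))
           (cong₂ _∧_ (and-zipWith⁺ (compatible p s) β₁ σ₁ p< s< (λ p′ s′ → compatible-<⁺ p s p′ s′))
                      (and-zipWith⁺ (compatible p s) β₂ σ₂ p> s> (λ p′ s′ → compatible->⁺ p s p′ s′))))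
    (orderIso-++⁺ β₁ β₂ σ₁ σ₂ (ℕ.suc-injective len) β₁↑ σ₁↑ β₁≫β₂ σ₁≫σ₂ iso)

record ContainsSplit (X Y β : List ℕ) : Set where
  field
    β₁ β₂ : List ℕ
    β≡    : β ≡ β₁ ++ β₂
    short : length β₁ ≤ length X
    β₁↑   : Increasing β₁
    β₁≫β₂ : β₁ ≫ β₂
    Y⊇β₂  : contains Y β₂ ≡ true

contains-++⁻ : ∀ X Y β → Increasing X → X ≫ Y → contains (X ++ Y) β ≡ true → ContainsSplit X Y β
contains-++⁻ X Y β X↑ X≫Y h with contains⁻ (X ++ Y) β h
... | s , s⊆ , iso with ⊆-++⁻ X Y s⊆
... | s₁ , s₂ , refl , s₁⊆X , s₂⊆Y with orderIso-++⁻ s₁ s₂ β (Increasing-⊆ s₁⊆X X↑) (≫-⊆ s₁⊆X s₂⊆Y X≫Y) iso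
... | record { β₁ = β₁ ; β₂ = β₂ ; β≡ = β≡ ; length≡ = len ; β₁↑ = β₁↑ ; β₁≫β₂ = β₁≫β₂ ; iso₂ = iso₂ } = record
  { β₁ = β₁ ; β₂ = β₂ ; β≡ = β≡ ; short = subst (_≤ length X) (sym len) (length-mono-≤ s₁⊆X)
  ; β₁↑ = β₁↑ ; β₁≫β₂ = β₁≫β₂ ; Y⊇β₂ = contains⁺ {β = β₂} s₂⊆Y iso₂ }

contains-++⁺ : ∀ X Y β₁ β₂ → Increasing X → X ≫ Y → length β₁ ≤ length X → Increasing β₁ → β₁ ≫ β₂ →
  contains Y β₂ ≡ true → contains (X ++ Y) (β₁ ++ β₂) ≡ true
contains-++⁺ X Y β₁ β₂ X↑ X≫Y short β₁↑ β₁≫β₂ h with contains⁻ Y β₂ h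
... | s₂ , s₂⊆Y , iso =
  contains⁺ {β = β₁ ++ β₂} (++⁺ prefix⊆X s₂⊆Y)
    (orderIso-++⁺ β₁ β₂ prefix s₂ prefix-length β₁↑ (Increasing-⊆ prefix⊆X X↑) β₁≫β₂ (≫-⊆ prefix⊆X s₂⊆Y X≫Y) iso)
  where
  prefix : List ℕ
  prefix = take (length β₁) X
  prefix-length : length β₁ ≡ length prefix
  prefix-length = sym (trans (List.length-take (length β₁) X) (ℕ.m≤n⇒m⊓n≡m short))
  prefix⊆X : prefix ⊆ X
  prefix⊆X = take-⊆ (length β₁) X

-- Layered permutations

block : ℕ → ℕ → List ℕ
block s zero    = []
block s (suc a) = suc s ∷ block (suc s) a

layered : List ℕ → List ℕ
layered []      = []
layered (a ∷ r) = block (sum r) a ++ layered r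

block-length : ∀ s a → length (block s a) ≡ a
block-length s zero    = refl
block-length s (suc a) = cong suc (block-length (suc s) a)

block-> : ∀ s a → All (s <_) (block s a)
block-> s zero    = []
block-> s (suc a) = ℕ.≤-refl ∷ All.map (ℕ.<-trans (ℕ.n<1+n s)) (block-> (suc s) a)

block-≤ : ∀ s a → All (_≤ s ℕ.+ a) (block s a)
block-≤ s zero    = []
block-≤ s (suc a) = subst (λ m → All (_≤ m) (block s (suc a))) (sym (ℕ.+-suc s a))
  (s≤s (ℕ.m≤m+n s a) ∷ block-≤ (suc s) a)

block-increasing : ∀ s a → Increasing (block s a)
block-increasing s zero    = []
block-increasing s (suc a) = block-> (suc s) a ∷ block-increasing (suc s) a

block-≫ : ∀ s a {Y} → All (_≤ s) Y → block s a ≫ Y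
block-≫ s a Y≤s = All.map (λ s<x → All.map (λ y≤s → ℕ.≤-<-trans y≤s s<x) Y≤s) (block-> s a)

layered-≤ : ∀ c → All (_≤ sum c) (layered c)
layered-≤ []      = []
layered-≤ (a ∷ r) = All.++⁺
  (subst (λ m → All (_≤ m) (block (sum r) a)) (ℕ.+-comm (sum r) a) (block-≤ (sum r) a))
  (All.map (λ x≤ → ℕ.≤-trans x≤ (ℕ.m≤n+m (sum r) a)) (layered-≤ r))

block≫layered : ∀ a r → block (sum r) a ≫ layered r
block≫layered a r = block-≫ (sum r) a (layered-≤ r)

NoTopPrefix : List ℕ → Set
NoTopPrefix β = ∀ β₁ β₂ → β ≡ β₁ ++ β₂ → Increasing β₁ → β₁ ≫ β₂ → β₁ ≡ []

layered-avoids : ∀ β → contains [] β ≡ false → NoTopPrefix β → ∀ c → contains (layered c) β ≡ false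
layered-avoids β []⊉β top []      = []⊉β
layered-avoids β []⊉β top (a ∷ r) with contains (layered (a ∷ r)) β in h
... | false = refl
... | true with contains-++⁻ (block (sum r) a) (layered r) β (block-increasing (sum r) a) (block≫layered a r) h
... | record { β₁ = β₁ ; β₂ = β₂ ; β≡ = β≡ ; β₁↑ = β₁↑ ; β₁≫β₂ = β₁≫β₂ ; Y⊇β₂ = Y⊇β₂ }
  with top β₁ β₂ β≡ β₁↑ β₁≫β₂
... | refl = contradiction (trans (sym (subst (λ γ → contains (layered r) γ ≡ true) (sym β≡) Y⊇β₂))
                                 (layered-avoids β []⊉β top r)) (λ ())

noTopPrefix-132 : NoTopPrefix p132
noTopPrefix-132 []                    β₂ _    _ _ = refl
noTopPrefix-132 (_ ∷ [])              β₂ refl _ ((s≤s () ∷ _) ∷ _)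
noTopPrefix-132 (_ ∷ _ ∷ [])          β₂ refl _ ((s≤s () ∷ _) ∷ _)
noTopPrefix-132 (_ ∷ _ ∷ _ ∷ [])      β₂ refl (_ ∷ (s≤s (s≤s ()) ∷ _) ∷ _) _
noTopPrefix-132 (_ ∷ _ ∷ _ ∷ _ ∷ _)   β₂ ()   _ _

noTopPrefix-213 : NoTopPrefix p213
noTopPrefix-213 []                    β₂ _    _ _ = refl
noTopPrefix-213 (_ ∷ [])              β₂ refl _ ((_ ∷ s≤s (s≤s ()) ∷ _) ∷ _)
noTopPrefix-213 (_ ∷ _ ∷ [])          β₂ refl ((s≤s () ∷ _) ∷ _) _
noTopPrefix-213 (_ ∷ _ ∷ _ ∷ [])      β₂ refl ((s≤s () ∷ _) ∷ _) _
noTopPrefix-213 (_ ∷ _ ∷ _ ∷ _ ∷ _)   β₂ ()   _ _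

layered-avoids-132 : ∀ c → avoids (layered c) p132 ≡ true
layered-avoids-132 c = cong not (layered-avoids p132 refl noTopPrefix-132 c)

layered-avoids-213 : ∀ c → avoids (layered c) p213 ≡ true
layered-avoids-213 c = cong not (layered-avoids p213 refl noTopPrefix-213 c)

pivot-split : ∀ {b} B R β₁ β₂ → B ++ R ≡ β₁ ++ β₂ →
  All (b <_) B → All (_< b) R → All (b <_) β₁ → All (_< b) β₂ → β₁ ≡ B × β₂ ≡ R
pivot-split []      R []       β₂ eq   _          _          _          _          = refl , sym eq
pivot-split []      R (y ∷ β₁) β₂ refl _          (y<b ∷ _)  (b<y ∷ _)  _          = ⊥-elim (ℕ.<-asym b<y y<b)
pivot-split (x ∷ B) R []       β₂ refl (b<x ∷ _)  _          _          (x<b ∷ _)  = ⊥-elim (ℕ.<-asym b<x x<b)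
pivot-split (x ∷ B) R (y ∷ β₁) β₂ eq   (_ ∷ b<B)  R<b        (_ ∷ b<β₁) β₂<b with List.∷-injective eq
... | refl , eq′ with pivot-split B R β₁ β₂ eq′ b<B R<b b<β₁ β₂<b
... | refl , refl = refl , refl

embeds⇒contains : ∀ t c → embeds t c ≡ true → contains (layered c) (layered t) ≡ true
embeds⇒contains []      c       _ = contains⁺ {β = []} ([]⊆-universal (layered c)) refl
embeds⇒contains (d ∷ t) (a ∷ r) h with embeds (d ∷ t) r in tail-embeds
... | true  = contains-++⁺ (block (sum r) a) (layered r) [] (layered (d ∷ t))
                (block-increasing (sum r) a) (block≫layered a r) z≤n [] [] (embeds⇒contains (d ∷ t) r tail-embeds)
... | false = contains-++⁺ (block (sum r) a) (layered r) (block (sum t) d) (layered t)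
                (block-increasing (sum r) a) (block≫layered a r) short
                (block-increasing (sum t) d) (block≫layered d t) (embeds⇒contains t r (Bool.∧-conicalʳ _ _ h))
  where
  short : length (block (sum t) d) ≤ length (block (sum r) a)
  short = subst₂ _≤_ (sym (block-length (sum t) d)) (sym (block-length (sum r) a))
            (ℕ.≤ᵇ⇒≤ d a (≡⇒T (Bool.∧-conicalˡ _ _ h)))

contains⇒embeds : ∀ t c → All (0 <_) t → contains (layered c) (layered t) ≡ true → embeds t c ≡ true
contains⇒embeds []          c       _         _ = refl
contains⇒embeds (zero ∷ t)  c       (() ∷ _)  _
contains⇒embeds (suc d ∷ t) []      _         ()
contains⇒embeds (suc d ∷ t) (a ∷ r) (_ ∷ t⁺) h
  with contains-++⁻ (block (sum r) a) (layered r) (layered (suc d ∷ t)) (block-increasing (sum r) a) (block≫layered a r) h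
... | record { β₁ = [] ; β≡ = refl ; Y⊇β₂ = Y⊇β₂ } =
  cong (_∨ ((suc d ≤ᵇ a) ∧ embeds t r)) (contains⇒embeds (suc d ∷ t) r (s≤s z≤n ∷ t⁺) Y⊇β₂)
... | record { β₁ = p ∷ β₁ ; β₂ = β₂ ; β≡ = β≡ ; short = short ; β₁↑ = p<β₁ ∷ _ ; β₁≫β₂ = β₂<p ∷ _ ; Y⊇β₂ = Y⊇β₂ }
  with List.∷-injective β≡
... | refl , β≡′ with pivot-split (block (suc (sum t)) d) (layered t) β₁ β₂ β≡′
                        (block-> (suc (sum t)) d) (All.map s≤s (layered-≤ t)) p<β₁ β₂<p
... | refl , refl =
  trans (cong (embeds (suc d ∷ t) r ∨_) (cong₂ _∧_ (T⇒≡ (ℕ.≤⇒≤ᵇ d<a)) (contains⇒embeds t r t⁺ Y⊇β₂)))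
        (Bool.∨-zeroʳ _)
  where
  d<a : suc d ≤ a
  d<a = subst₂ _≤_ (cong suc (block-length (suc (sum t)) d)) (block-length (sum r) a) short

contains-layered : ∀ t c → All (0 <_) t → contains (layered c) (layered t) ≡ embeds t c
contains-layered t c t⁺ with embeds t c in t↪c
... | true  = embeds⇒contains t c t↪c
... | false with contains (layered c) (layered t) in c⊇t
...   | false = refl
...   | true  = trans (sym (contains⇒embeds t c t⁺ c⊇t)) t↪c

-- The permutations avoiding 132 and 213 are the layered ones

avoidsBoth : List ℕ → Bool
avoidsBoth α = avoids α p132 ∧ avoids α p213

avoidsBoth-layered : ∀ c → avoidsBoth (layered c) ≡ true
avoidsBoth-layered c = cong₂ _∧_ (layered-avoids-132 c) (layered-avoids-213 c)

contains-132⇒¬avoidsBoth : ∀ {l} → contains l p132 ≡ true → avoidsBoth l ≡ false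
contains-132⇒¬avoidsBoth h rewrite h = refl

contains-213⇒¬avoidsBoth : ∀ {l} → contains l p213 ≡ true → avoidsBoth l ≡ false
contains-213⇒¬avoidsBoth {l} h rewrite h = Bool.∧-zeroʳ (avoids l p132)

avoidsBoth-⊆ : ∀ {α l} → α ⊆ l → avoidsBoth α ≡ false → avoidsBoth l ≡ false
avoidsBoth-⊆ {α} {l} α⊆l h with contains α p132 in α⊇132 | contains α p213 in α⊇213
... | true  | _     = contains-132⇒¬avoidsBoth {l} (contains-⊆ p132 α⊆l α⊇132)
... | false | true  = contains-213⇒¬avoidsBoth {l} (contains-⊆ p213 α⊆l α⊇213)
... | false | false with () ← h

insertAll-⊇ : ∀ N α → All (α ⊆_) (insertAll N α)
insertAll-⊇ N []       = (N ∷ʳ []) ∷ []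
insertAll-⊇ N (y ∷ ys) = (N ∷ʳ ⊆-refl) ∷ All.map⁺ (All.map (refl ∷_) (insertAll-⊇ N ys))

iso-132 : ∀ {u y N} → u < y → y < N → orderIso p132 (u ∷ N ∷ y ∷ []) ≡ true
iso-132 u<y y<N
  rewrite <ᵇ-true (ℕ.<-trans u<y y<N) | <ᵇ-false (ℕ.<⇒≤ (ℕ.<-trans u<y y<N))
        | <ᵇ-true u<y | <ᵇ-false (ℕ.<⇒≤ u<y) | <ᵇ-true y<N | <ᵇ-false (ℕ.<⇒≤ y<N) = refl

iso-213 : ∀ {u v N} → v < u → u < N → orderIso p213 (u ∷ v ∷ N ∷ []) ≡ true
iso-213 v<u u<N
  rewrite <ᵇ-true (ℕ.<-trans v<u u<N) | <ᵇ-false (ℕ.<⇒≤ (ℕ.<-trans v<u u<N))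
        | <ᵇ-true v<u | <ᵇ-false (ℕ.<⇒≤ v<u) | <ᵇ-true u<N | <ᵇ-false (ℕ.<⇒≤ u<N) = refl

private
  accept : ∀ l ls → avoidsBoth l ≡ true → filterᵇ avoidsBoth (l ∷ ls) ≡ l ∷ filterᵇ avoidsBoth ls
  accept l ls h = List.filter-accept (T? ∘ avoidsBoth) {x = l} {xs = ls} (≡⇒T h)

  reject : ∀ l ls → avoidsBoth l ≡ false → filterᵇ avoidsBoth (l ∷ ls) ≡ filterᵇ avoidsBoth ls
  reject l ls h = List.filter-reject (T? ∘ avoidsBoth) {x = l} {xs = ls} (subst T h)

map-++-∷ : ∀ (pre : List ℕ) y L → map (pre ++_) (map (y ∷_) L) ≡ map ((pre ++ [ y ]) ++_) L
map-++-∷ pre y L = trans (sym (List.map-∘ L)) (List.map-cong (λ l → sym (List.++-assoc pre [ y ] l)) L)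

filter-insert-132 : ∀ N pre u W V → [ u ] ⊆ pre → All (u <_) W → All (_< N) W →
  filterᵇ avoidsBoth (map (pre ++_) (insertAll N (W ++ V)))
    ≡ filterᵇ avoidsBoth (map ((pre ++ W) ++_) (insertAll N V))
filter-insert-132 N pre u []      V u∈pre _           _           rewrite List.++-identityʳ pre = refl
filter-insert-132 N pre u (y ∷ W) V u∈pre (u<y ∷ u<W) (y<N ∷ W<N) = begin
  filterᵇ avoidsBoth ((pre ++ N ∷ y ∷ W ++ V) ∷ map (pre ++_) (map (y ∷_) (insertAll N (W ++ V))))
    ≡⟨ reject (pre ++ N ∷ y ∷ W ++ V) _ rejected ⟩
  filterᵇ avoidsBoth (map (pre ++_) (map (y ∷_) (insertAll N (W ++ V))))
    ≡⟨ cong (filterᵇ avoidsBoth) (map-++-∷ pre y (insertAll N (W ++ V))) ⟩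
  filterᵇ avoidsBoth (map ((pre ++ [ y ]) ++_) (insertAll N (W ++ V)))
    ≡⟨ filter-insert-132 N (pre ++ [ y ]) u W V (++⁺ u∈pre (y ∷ʳ [])) u<W W<N ⟩
  filterᵇ avoidsBoth (map (((pre ++ [ y ]) ++ W) ++_) (insertAll N V))
    ≡⟨ cong (λ p → filterᵇ avoidsBoth (map (p ++_) (insertAll N V))) (List.++-assoc pre [ y ] W) ⟩
  filterᵇ avoidsBoth (map ((pre ++ y ∷ W) ++_) (insertAll N V)) ∎
  where
  open ≡-Reasoning
  rejected : avoidsBoth (pre ++ N ∷ y ∷ W ++ V) ≡ false
  rejected = contains-132⇒¬avoidsBoth {pre ++ N ∷ y ∷ W ++ V}
    (contains⁺ {β = p132} (++⁺ u∈pre (refl ∷ refl ∷ []⊆-universal (W ++ V))) (iso-132 u<y y<N))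

filter-insert-213 : ∀ N pre u v V → u ∷ v ∷ [] ⊆ pre → v < u → u < N →
  filterᵇ avoidsBoth (map (pre ++_) (insertAll N V)) ≡ []
filter-insert-213 N pre u v []      uv⊆pre v<u u<N = reject (pre ++ N ∷ []) [] (rejected pre [] uv⊆pre)
  where
  rejected : ∀ pre V → u ∷ v ∷ [] ⊆ pre → avoidsBoth (pre ++ N ∷ V) ≡ false
  rejected pre V uv⊆pre = contains-213⇒¬avoidsBoth {pre ++ N ∷ V}
    (contains⁺ {β = p213} (++⁺ uv⊆pre (refl ∷ []⊆-universal V)) (iso-213 v<u u<N))
filter-insert-213 N pre u v (y ∷ V) uv⊆pre v<u u<N = begin
  filterᵇ avoidsBoth ((pre ++ N ∷ y ∷ V) ∷ map (pre ++_) (map (y ∷_) (insertAll N V)))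
    ≡⟨ reject (pre ++ N ∷ y ∷ V) _ (contains-213⇒¬avoidsBoth {pre ++ N ∷ y ∷ V}
         (contains⁺ {β = p213} (++⁺ uv⊆pre (refl ∷ []⊆-universal (y ∷ V))) (iso-213 v<u u<N))) ⟩
  filterᵇ avoidsBoth (map (pre ++_) (map (y ∷_) (insertAll N V)))
    ≡⟨ cong (filterᵇ avoidsBoth) (map-++-∷ pre y (insertAll N V)) ⟩
  filterᵇ avoidsBoth (map ((pre ++ [ y ]) ++_) (insertAll N V))
    ≡⟨ filter-insert-213 N (pre ++ [ y ]) u v V (++⁺ uv⊆pre (y ∷ʳ [])) v<u u<N ⟩
  [] ∎
  where open ≡-Reasoning

filter-insert-end : ∀ N pre u Y → [ u ] ⊆ pre → All (_< u) Y → u < N → avoidsBoth (pre ++ N ∷ Y) ≡ true →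
  filterᵇ avoidsBoth (map (pre ++_) (insertAll N Y)) ≡ [ pre ++ N ∷ Y ]
filter-insert-end N pre u []      u∈pre _         u<N ok = accept (pre ++ N ∷ []) [] ok
filter-insert-end N pre u (y ∷ Y) u∈pre (y<u ∷ _) u<N ok = begin
  filterᵇ avoidsBoth ((pre ++ N ∷ y ∷ Y) ∷ map (pre ++_) (map (y ∷_) (insertAll N Y)))
    ≡⟨ accept (pre ++ N ∷ y ∷ Y) _ ok ⟩
  (pre ++ N ∷ y ∷ Y) ∷ filterᵇ avoidsBoth (map (pre ++_) (map (y ∷_) (insertAll N Y)))
    ≡⟨ cong ((pre ++ N ∷ y ∷ Y) ∷_) (trans (cong (filterᵇ avoidsBoth) (map-++-∷ pre y (insertAll N Y)))
         (filter-insert-213 N (pre ++ [ y ]) u y Y (++⁺ u∈pre (refl ∷ [])) y<u u<N)) ⟩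
  [ pre ++ N ∷ y ∷ Y ] ∎
  where open ≡-Reasoning

block-snoc : ∀ s a → block s (suc a) ≡ block s a ++ [ suc (s ℕ.+ a) ]
block-snoc s zero    = cong (λ m → [ suc m ]) (sym (ℕ.+-identityʳ s))
block-snoc s (suc a) = cong (suc s ∷_)
  (trans (block-snoc (suc s) a) (cong (λ m → block (suc s) a ++ [ suc m ]) (sym (ℕ.+-suc s a))))

-- The new maximum may only go in front or directly after the first block:
-- inside the first block it creates a 132, further right a 213.
filter-insertAll-layered : ∀ c → All (0 <_) c →
  filterᵇ avoidsBoth (insertAll (suc (sum c)) (layered c)) ≡ map layered (extend c)
filter-insertAll-layered []          _        = refl
filter-insertAll-layered (zero ∷ r)  (() ∷ _)
filter-insertAll-layered (suc a ∷ r) _        = begin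
  filterᵇ avoidsBoth ((N ∷ layered (suc a ∷ r)) ∷ map (suc s ∷_) (insertAll N (W ++ Y)))
    ≡⟨ accept (layered (1 ∷ suc a ∷ r)) _ (avoidsBoth-layered (1 ∷ suc a ∷ r)) ⟩
  layered (1 ∷ suc a ∷ r) ∷ filterᵇ avoidsBoth (map ([ suc s ] ++_) (insertAll N (W ++ Y)))
    ≡⟨ cong (layered (1 ∷ suc a ∷ r) ∷_) (filter-insert-132 N [ suc s ] (suc s) W Y ⊆-refl (block-> (suc s) a) W<N) ⟩
  layered (1 ∷ suc a ∷ r) ∷ filterᵇ avoidsBoth (map ((suc s ∷ W) ++_) (insertAll N Y))
    ≡⟨ cong (layered (1 ∷ suc a ∷ r) ∷_) (filter-insert-end N (suc s ∷ W) (suc s) Y (refl ∷ []⊆-universal W)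
         (All.map s≤s (layered-≤ r)) s<N (subst (λ l → avoidsBoth l ≡ true) grown (avoidsBoth-layered (suc (suc a) ∷ r)))) ⟩
  layered (1 ∷ suc a ∷ r) ∷ [ (suc s ∷ W) ++ N ∷ Y ]
    ≡⟨ cong (λ l → layered (1 ∷ suc a ∷ r) ∷ [ l ]) grown ⟨
  map layered (extend (suc a ∷ r)) ∎
  where
  open ≡-Reasoning
  s N : ℕ
  s = sum r
  N = suc (suc a ℕ.+ s)
  W Y : List ℕ
  W = block (suc s) a
  Y = layered r
  W<N : All (_< N) W
  W<N = All.map (λ x≤ → s≤s (ℕ.≤-trans x≤ (ℕ.≤-reflexive (cong suc (ℕ.+-comm s a))))) (block-≤ (suc s) a)
  s<N : suc s < N
  s<N = s≤s (s≤s (ℕ.m≤n+m s a))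
  grown : layered (suc (suc a) ∷ r) ≡ (suc s ∷ W) ++ N ∷ Y
  grown = begin
    (suc s ∷ block (suc s) (suc a)) ++ Y       ≡⟨ cong (λ b → (suc s ∷ b) ++ Y) (block-snoc (suc s) a) ⟩
    (suc s ∷ W ++ [ suc (suc s ℕ.+ a) ]) ++ Y  ≡⟨ cong (suc s ∷_) (List.++-assoc W [ suc (suc s ℕ.+ a) ] Y) ⟩
    suc s ∷ W ++ suc (suc s ℕ.+ a) ∷ Y         ≡⟨ cong (λ m → suc s ∷ W ++ suc (suc m) ∷ Y) (ℕ.+-comm s a) ⟩
    (suc s ∷ W) ++ N ∷ Y                       ∎

compositions-valid : ∀ n → All (λ c → sum c ≡ n × All (0 <_) c) (compositions n)
compositions-valid zero    = (refl , []) ∷ []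
compositions-valid (suc n) = All.concat⁺ (All.map⁺ (All.map extend-valid (compositions-valid n)))
  where
  extend-valid : ∀ {c} → sum c ≡ n × All (0 <_) c → All (λ c′ → sum c′ ≡ suc n × All (0 <_) c′) (extend c)
  extend-valid {[]}    (refl , c⁺)      = (refl , s≤s z≤n ∷ []) ∷ []
  extend-valid {a ∷ r} (refl , a⁺ ∷ r⁺) = (refl , s≤s z≤n ∷ a⁺ ∷ r⁺) ∷ (refl , s≤s z≤n ∷ r⁺) ∷ []

filterᵇ-concatMap : ∀ (p : List ℕ → Bool) (h : List ℕ → List (List ℕ)) xs →
  filterᵇ p (concatMap h xs) ≡ concatMap (filterᵇ p ∘ h) xs
filterᵇ-concatMap p h []       = refl
filterᵇ-concatMap p h (x ∷ xs) =
  trans (List.filter-++ (T? ∘ p) (h x) (concatMap h xs)) (cong (filterᵇ p (h x) ++_) (filterᵇ-concatMap p h xs))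

concatMap-filterᵇ : ∀ (p : List ℕ → Bool) (k : List ℕ → List (List ℕ)) xs → (∀ x → p x ≡ false → k x ≡ []) →
  concatMap k xs ≡ concatMap k (filterᵇ p xs)
concatMap-filterᵇ p k []       _     = refl
concatMap-filterᵇ p k (x ∷ xs) k≡[] with p x in px
... | true  = cong (k x ++_) (concatMap-filterᵇ p k xs k≡[])
... | false = trans (cong (_++ concatMap k xs) (k≡[] x px)) (concatMap-filterᵇ p k xs k≡[])

filter-insertAll-¬avoidsBoth : ∀ N α → avoidsBoth α ≡ false → filterᵇ avoidsBoth (insertAll N α) ≡ []
filter-insertAll-¬avoidsBoth N α h =
  List.filter-none (T? ∘ avoidsBoth) (All.map (λ α⊆l → subst T (avoidsBoth-⊆ α⊆l h)) (insertAll-⊇ N α))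

filter-perms : ∀ n → filterᵇ avoidsBoth (perms n) ≡ map layered (compositions n)
filter-perms zero    = refl
filter-perms (suc n) = begin
  filterᵇ avoidsBoth (concatMap (insertAll (suc n)) (perms n))
    ≡⟨ filterᵇ-concatMap avoidsBoth (insertAll (suc n)) (perms n) ⟩
  concatMap insertAvoiders (perms n)
    ≡⟨ concatMap-filterᵇ avoidsBoth insertAvoiders (perms n) (filter-insertAll-¬avoidsBoth (suc n)) ⟩
  concatMap insertAvoiders (filterᵇ avoidsBoth (perms n))
    ≡⟨ cong (concatMap insertAvoiders) (filter-perms n) ⟩
  concatMap insertAvoiders (map layered (compositions n))
    ≡⟨ List.concatMap-map insertAvoiders layered (compositions n) ⟩
  concatMap (insertAvoiders ∘ layered) (compositions n)
    ≡⟨ cong concat (List.map-cong-local (All.map layered-step (compositions-valid n))) ⟩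
  concatMap (map layered ∘ extend) (compositions n)
    ≡⟨ List.map-concatMap layered extend (compositions n) ⟨
  map layered (compositions (suc n)) ∎
  where
  open ≡-Reasoning
  insertAvoiders : List ℕ → List (List ℕ)
  insertAvoiders = filterᵇ avoidsBoth ∘ insertAll (suc n)
  layered-step : ∀ {c} → sum c ≡ n × All (0 <_) c → insertAvoiders (layered c) ≡ map layered (extend c)
  layered-step {c} (refl , c⁺) = filter-insertAll-layered c c⁺

range-suc : ∀ k → range (suc k) ≡ range k ++ [ suc k ]
range-suc k = trans (cong (map suc) (sym (List.applyUpTo-∷ʳ id k))) (List.map-++ suc (upTo k) [ k ])

insertAll-∈ : ∀ N xs ys → xs ++ N ∷ ys ∈ insertAll N (xs ++ ys)
insertAll-∈ N []       []       = here refl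
insertAll-∈ N []       (y ∷ ys) = here refl
insertAll-∈ N (x ∷ xs) ys       = there (∈-map⁺ (x ∷_) (insertAll-∈ N xs ys))

perms-complete : ∀ k τ → τ ↭ range k → τ ∈ perms k
perms-complete zero    τ τ↭ rewrite ↭-empty-inv τ↭ = here refl
perms-complete (suc k) τ τ↭ with ∈-∃++ top∈τ
  where
  top∈τ : suc k ∈ τ
  top∈τ = ∈-resp-↭ (↭-sym τ↭) (subst (suc k ∈_) (sym (range-suc k)) (∈-insert (range k)))
... | xs , ys , refl = ∈-concatMap⁺ (insertAll (suc k)) (lose (perms-complete k (xs ++ ys) rest↭) (insertAll-∈ (suc k) xs ys))
  where
  rest↭ : xs ++ ys ↭ range k
  rest↭ = subst (xs ++ ys ↭_) (List.++-identityʳ (range k))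
            (drop-mid xs (range k) (subst (xs ++ [ suc k ] ++ ys ↭_) (range-suc k) τ↭))

countAvoiders-layered : ∀ t → All (0 <_) t → ∀ n → countAvoiders (layered t) n ≡ countComp (avoidsᶜ t) n
countAvoiders-layered t t⁺ n = begin
  length (filterᵇ (λ α → avoids α p132 ∧ avoids α p213 ∧ avoids α (layered t)) (perms n))
    ≡⟨ length-filterᵇ _ (perms n) ⟩
  count (λ α → avoids α p132 ∧ avoids α p213 ∧ avoids α (layered t)) (perms n)
    ≡⟨ count-cong (perms n) (λ α → sym (Bool.∧-assoc (avoids α p132) _ _)) ⟩
  count (λ α → avoidsBoth α ∧ avoids α (layered t)) (perms n)
    ≡⟨ count-filterᵇ (λ α → avoids α (layered t)) avoidsBoth (perms n) ⟨
  count (λ α → avoids α (layered t)) (filterᵇ avoidsBoth (perms n))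
    ≡⟨ cong (count (λ α → avoids α (layered t))) (filter-perms n) ⟩
  count (λ α → avoids α (layered t)) (map layered (compositions n))
    ≡⟨ count-map (λ α → avoids α (layered t)) layered (compositions n) ⟩
  count (λ c → avoids (layered c) (layered t)) (compositions n)
    ≡⟨ count-cong (compositions n) (λ c → cong not (contains-layered t c t⁺)) ⟩
  countComp (avoidsᶜ t) n ∎
  where
  open ≡-Reasoning

intervals : ∀ m → (Fin (suc m) → ℕ) → List ℕ
intervals m r = concatMap (λ i → interval (r (suc i)) (r (inject₁ i))) (allFin m)

Decreasing : ∀ m → (Fin (suc m) → ℕ) → Set
Decreasing m r = ∀ (i : Fin m) → r (suc i) < r (inject₁ i)

gaps : ∀ m → (Fin (suc m) → ℕ) → Fin m → ℕ
gaps m r i = r (inject₁ i) ∸ r (suc i)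

intervals-suc : ∀ m r → intervals (suc m) r ≡ interval (r (suc zero)) (r zero) ++ intervals m (r ∘ suc)
intervals-suc m r = cong (λ bs → interval (r (suc zero)) (r zero) ++ concat bs)
  (trans (List.map-tabulate suc h) (sym (List.map-tabulate id (h ∘ suc))))
  where
  h : Fin (suc m) → List ℕ
  h i = interval (r (suc i)) (r (inject₁ i))

applyUpTo-block : ∀ s n (h : ℕ → ℕ) → (∀ i → h i ≡ suc (s ℕ.+ i)) → applyUpTo h n ≡ block s n
applyUpTo-block s zero    h eq = refl
applyUpTo-block s (suc n) h eq = cong₂ _∷_ (trans (eq 0) (cong suc (ℕ.+-identityʳ s)))
  (applyUpTo-block (suc s) n (h ∘ suc) (λ i → trans (eq (suc i)) (cong suc (ℕ.+-suc s i))))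

interval-suc : ∀ s b → interval (suc s) b ≡ block s (b ∸ suc s)
interval-suc s b = trans (List.map-upTo (suc s ℕ.+_) (b ∸ suc s)) (applyUpTo-block s (b ∸ suc s) (suc s ℕ.+_) (λ _ → refl))

interval-≥ : ∀ a b → All (a ≤_) (interval a b)
interval-≥ a b = All.map⁺ (All.universal (ℕ.m≤m+n a) (upTo (b ∸ a)))

last≤first : ∀ m r → Decreasing m r → r (fromℕ m) ≤ r zero
last≤first zero    r dec = ℕ.≤-refl
last≤first (suc m) r dec = ℕ.≤-trans (last≤first m (r ∘ suc) (dec ∘ suc)) (ℕ.<⇒≤ (dec zero))

intervals-≥ : ∀ m r → Decreasing m r → All (r (fromℕ m) ≤_) (intervals m r)
intervals-≥ zero    r dec = []
intervals-≥ (suc m) r dec rewrite intervals-suc m r = All.++⁺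
  (All.map (ℕ.≤-trans (last≤first m (r ∘ suc) (dec ∘ suc))) (interval-≥ (r (suc zero)) (r zero)))
  (intervals-≥ m (r ∘ suc) (dec ∘ suc))

gaps-positive : ∀ m r → Decreasing m r → All (0 <_) (tabulate (gaps m r))
gaps-positive m r dec = All.tabulate⁺ (λ i → ℕ.m<n⇒0<n∸m (dec i))

sum-gaps : ∀ m r → Decreasing m r → sum (tabulate (gaps m r)) ℕ.+ r (fromℕ m) ≡ r zero
sum-gaps zero    r dec = refl
sum-gaps (suc m) r dec = begin
  (r zero ∸ r (suc zero) ℕ.+ sum (tabulate (gaps m (r ∘ suc)))) ℕ.+ r (fromℕ (suc m))
    ≡⟨ ℕ.+-assoc (r zero ∸ r (suc zero)) _ _ ⟩
  r zero ∸ r (suc zero) ℕ.+ (sum (tabulate (gaps m (r ∘ suc))) ℕ.+ r (suc (fromℕ m)))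
    ≡⟨ cong (r zero ∸ r (suc zero) ℕ.+_) (sum-gaps m (r ∘ suc) (dec ∘ suc)) ⟩
  r zero ∸ r (suc zero) ℕ.+ r (suc zero)
    ≡⟨ ℕ.m∸n+n≡m (ℕ.<⇒≤ (dec zero)) ⟩
  r zero ∎
  where open ≡-Reasoning

intervals≡layered : ∀ m r → Decreasing m r → r (fromℕ m) ≡ 1 → intervals m r ≡ layered (tabulate (gaps m r))
intervals≡layered zero    r dec last≡1 = refl
intervals≡layered (suc m) r dec last≡1 = begin
  intervals (suc m) r
    ≡⟨ intervals-suc m r ⟩
  interval (r (suc zero)) (r zero) ++ intervals m (r ∘ suc)
    ≡⟨ cong₂ _++_ (cong (λ a → interval a (r zero)) r₁≡) (intervals≡layered m (r ∘ suc) (dec ∘ suc) last≡1) ⟩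
  interval (suc s) (r zero) ++ layered (tabulate (gaps m (r ∘ suc)))
    ≡⟨ cong (_++ layered (tabulate (gaps m (r ∘ suc)))) (interval-suc s (r zero)) ⟩
  block s (r zero ∸ suc s) ++ layered (tabulate (gaps m (r ∘ suc)))
    ≡⟨ cong (λ a → block s (r zero ∸ a) ++ layered (tabulate (gaps m (r ∘ suc)))) r₁≡ ⟨
  layered (tabulate (gaps (suc m) r)) ∎
  where
  open ≡-Reasoning
  s : ℕ
  s = sum (tabulate (gaps m (r ∘ suc)))
  r₁≡ : r (suc zero) ≡ suc s
  r₁≡ = trans (sym (sum-gaps m (r ∘ suc) (dec ∘ suc))) (trans (cong (s ℕ.+_) last≡1) (ℕ.+-comm s 1))

suffixSums : (c : List ℕ) → Fin (suc (length c)) → ℕ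
suffixSums c i = suc (sum (drop (toℕ i) c))

suffixSums-decreasing : ∀ c → All (0 <_) c → Decreasing (length c) (suffixSums c)
suffixSums-decreasing c c⁺ i rewrite Fin.toℕ-inject₁ i = s≤s (drop-suc-< c (toℕ i) (Fin.toℕ<n i) c⁺)
  where
  drop-suc-< : ∀ c j → j < length c → All (0 <_) c → sum (drop (suc j) c) < sum (drop j c)
  drop-suc-< (a ∷ c) zero    _         (a⁺ ∷ _)  = ℕ.+-monoˡ-≤ (sum c) a⁺
  drop-suc-< (a ∷ c) (suc j) (s≤s j<) (_ ∷ c⁺) = drop-suc-< c j j< c⁺

layered≡intervals : ∀ c → layered c ≡ intervals (length c) (suffixSums c)
layered≡intervals []      = refl
layered≡intervals (a ∷ c) = sym (begin
  intervals (suc (length c)) (suffixSums (a ∷ c))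
    ≡⟨ intervals-suc (length c) (suffixSums (a ∷ c)) ⟩
  interval (suc (sum c)) (suc (a ℕ.+ sum c)) ++ intervals (length c) (suffixSums c)
    ≡⟨ cong₂ _++_ (trans (interval-suc (sum c) (suc (a ℕ.+ sum c))) (cong (block (sum c)) (ℕ.m+n∸n≡m a (sum c))))
                  (sym (layered≡intervals c)) ⟩
  layered (a ∷ c) ∎)
  where open ≡-Reasoning

layered-witness : ∀ k τ → τ ↭ range k → avoidsBoth τ ≡ true → ∃ λ c → sum c ≡ k × All (0 <_) c × τ ≡ layered c
layered-witness k τ τ↭ τ-avoids
  with ∈-map⁻ layered (subst (τ ∈_) (filter-perms k)
         (∈-filter⁺ (T? ∘ avoidsBoth) (perms-complete k τ τ↭) (≡⇒T τ-avoids)))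
... | c , c∈ , τ≡ with All.lookup (compositions-valid k) c∈
... | sum≡k , c⁺ = c , sum≡k , c⁺ , τ≡

representation : ∀ k τ → τ ↭ range k → avoidsBoth τ ≡ true →
  Σ ℕ λ m → Σ (Fin (suc m) → ℕ) λ r → r zero ≡ suc k × Decreasing m r × r (fromℕ m) ≥ 1 × τ ≡ intervals m r
representation k τ τ↭ τ-avoids with layered-witness k τ τ↭ τ-avoids
... | c , sum≡k , c⁺ , τ≡ =
  length c , suffixSums c , cong suc sum≡k , suffixSums-decreasing c c⁺ , s≤s z≤n , trans τ≡ (layered≡intervals c)

countAvoiders-intervals : ∀ m r → Decreasing (suc m) r → r (fromℕ (suc m)) ≡ 1 →
  ∀ n → + countAvoiders (intervals (suc m) r) n ≡ det (suc m) (theMatrix (suc m) (gaps (suc m) r)) n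
countAvoiders-intervals m r dec last≡1 n = begin
  + countAvoiders (intervals (suc m) r) n
    ≡⟨ cong (λ τ → + countAvoiders τ n) (intervals≡layered (suc m) r dec last≡1) ⟩
  + countAvoiders (layered t) n
    ≡⟨ cong +_ (countAvoiders-layered t t⁺ n) ⟩
  gf (avoidsᶜ t) n
    ≡⟨ gf-avoidsᶜ≗nestFG t t⁺ n ⟩
  nestFG t n
    ≡⟨ det-theMatrix m (gaps (suc m) r) n ⟨
  det (suc m) (theMatrix (suc m) (gaps (suc m) r)) n ∎
  where
  open ≡-Reasoning
  t : List ℕ
  t = tabulate (gaps (suc m) r)
  t⁺ : All (0 <_) t
  t⁺ = gaps-positive (suc m) r dec

1∈-↭range : ∀ k τ → k ≥ 1 → τ ↭ range k → 1 ∈ τ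
1∈-↭range (suc k) τ _ τ↭ = ∈-resp-↭ (↭-sym τ↭) (here refl)

-- The value 1 occurs in τ, and no entry of τ lies below r (fromℕ m).
countAvoiders-det : ∀ k τ → k ≥ 1 → τ ↭ range k → ∀ m r → Decreasing m r → r (fromℕ m) ≥ 1 → τ ≡ intervals m r →
  ∀ n → + countAvoiders τ n ≡ det m (theMatrix m (gaps m r)) n
countAvoiders-det k τ k≥1 τ↭ zero    r _   _      τ≡ n with () ← subst (1 ∈_) τ≡ (1∈-↭range k τ k≥1 τ↭)
countAvoiders-det k τ k≥1 τ↭ (suc m) r dec last≥1 τ≡ n =
  trans (cong (λ σ → + countAvoiders σ n) τ≡) (countAvoiders-intervals m r dec last≡1 n)
  where
  last≡1 : r (fromℕ (suc m)) ≡ 1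
  last≡1 = ℕ.≤-antisym (All.lookup (intervals-≥ (suc m) r dec) (subst (1 ∈_) τ≡ (1∈-↭range k τ k≥1 τ↭))) last≥1

theorem3 : (k : ℕ) → k ≥ 1 → (τ : List ℕ) → τ ↭ range k →
    avoids τ p132 ≡ true → avoids τ p213 ≡ true →
    (Σ ℕ λ m → Σ (Fin (suc m) → ℕ) λ r →
        r zero ≡ suc k × (∀ (i : Fin m) → r (suc i) < r (inject₁ i)) × r (fromℕ m) ≥ 1
        × τ ≡ concatMap (λ i → interval (r (suc i)) (r (inject₁ i))) (allFin m))
    × ((m : ℕ) → (r : Fin (suc m) → ℕ) →
        r zero ≡ suc k → (∀ (i : Fin m) → r (suc i) < r (inject₁ i)) → r (fromℕ m) ≥ 1 →
        τ ≡ concatMap (λ i → interval (r (suc i)) (r (inject₁ i))) (allFin m) →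
        ∀ n → + countAvoiders τ n ≡ det m (theMatrix m (λ i → r (inject₁ i) ∸ r (suc i))) n)
theorem3 k k≥1 τ τ↭ avoids-132 avoids-213 =
  representation k τ τ↭ (cong₂ _∧_ avoids-132 avoids-213) ,
  λ m r _ → countAvoiders-det k τ k≥1 τ↭ m r
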